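{- Let $\lambda,\mu$ be partitions with at most $n$ parts, $\mu\subseteq\lambda$, and let $r,s$ be weakly increasing sequences of $n$ positive integers. Let $1\le k\le n-1$ satisfy $\mu_k<\lambda_k$, $r_k\le s_k$, $s_k=s_{k+1}$ and $\lambda_k=\lambda_{k+1}$. Let $\epsilon_k$ denote the $k$th unit vector of length $n$. Then \[ G^{\mathrm{row}(r,s)}_{\lambda/\mu}(x;\alpha,\beta)=G^{\mathrm{row}(r,s-\epsilon_k)}_{\lambda/\mu}(x;\alpha,\beta),\qquad \widetilde G^{\mathrm{row}(r,s)}_{\lambda/\mu}(x;\alpha,\beta)=\widetilde G^{\mathrm{row}(r,s-\epsilon_k)}_{\lambda/\mu}(x;\alpha,\beta). \] Moreover, if $s_k=1$ then $G^{\mathrm{row}(r,s-\epsilon_k)}_{\lambda/\mu}(x;\alpha,\beta)=\widetilde G^{\mathrm{row}(r,s-\epsilon_k)}_{\lambda/\mu}(x;\alpha,\beta)=0$.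
   Context: Indeterminates $x=(x_1,x_2,\dots)$, $\alpha=(\alpha_i)$, $\beta=(\beta_i)$. $A_m=\alpha_1+\dots+\alpha_m$, $B_m=\beta_1+\dots+\beta_m$ ($=0$ for $m\le0$); $X_{[r,s]}=x_r+\dots+x_s$ ($=0$ if $r>s$). For a formal $\mathbb Z$-linear combination $Z=\sum_vc_vv$ of finitely many indeterminates, $h_m[Z]$ is the coefficient of $t^m$ in $\prod_v(1-vt)^{ -c_v}$; $h_m[Y\ominus Z]=\sum_{b\ge0}h_{m+b}[Y]h_b[Z]$. For partitions $\lambda,\mu$ with at most $n$ parts (padded with zeros) and $r,s\in\mathbb Z_{\ge0}^n$, \[ \widetilde G^{\mathrm{row}(r,s)}_{\lambda/\mu}(x;\alpha,\beta)=\prod_{i=1}^n\prod_{l=r_i}^{s_i}(1-\beta_ix_l)\cdot\det\Big(h_{\lambda_i-\mu_j-i+j}\big[X_{[r_j,s_i]}\ominus(A_{\lambda_i}-A_{\mu_j}-B_{i-1}+B_j)\big]\Big)_{i,j=1}^n. \] A marked multiset-valued tableau of skew shape $\lambda/\mu$ (cells $(i,j)$ with $\mu_i<j\le\lambda_i$) is a filling $T$ with nonempty finite multisets $\{a_1\le\dots\le a_k\}$ of positive integers, where each $a_t$ with $t\ge2$, $a_{t-1}<a_t$ may be marked, such that $\max T(i,j)\le\min T(i,j+1)$ and $\max T(i,j)<\min T(i+1,j)$ whenever both cells are in the shape; $\mathrm{wt}(T)=\prod x^{T(i,j)}\alpha_j^{u(i,j)-1}(-\beta_i)^{m(i,j)}$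 with $x^{T(i,j)}=\prod_kx_k^{(\#k\text{ in }T(i,j))}$, $u,m$ the numbers of unmarked/marked elements. For $r,s\in\mathbb Z_{\ge0}^n$, $G^{\mathrm{row}(r,s)}_{\lambda/\mu}(x;\alpha,\beta)$ is the sum of $\mathrm{wt}(T)$ over such $T$ with $r_i\le\min T(i,j)$, $\max T(i,j)\le s_i$ for all cells (rows of $\lambda/\mu$ containing no cells impose no condition). -}

module Defs where

open import Level using (Level)
open import Algebra.Bundles using (CommutativeRing)
open import Data.Nat as N using (ℕ; zero; suc; _∸_; _≤ᵇ_; _<ᵇ_; _≡ᵇ_; _≤_; _<_)
open import Data.Integer as Z using (ℤ; +_; -[1+_])
open import Data.Bool using (Bool; true; false; if_then_else_; _∧_; _∨_; not)
open import Data.List using (List; []; _∷_; map; concatMap; foldr; length; zip; _++_)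
open import Data.Maybe using (Maybe; just; nothing)
open import Data.Product using (_×_; _,_; proj₁; proj₂)
open import Data.Fin using (Fin; toℕ; punchIn)
import Data.Fin as F

-- Conventions: all sequences (λ, μ, r, s, x, α, β) are functions ℕ → _,
-- 1-indexed; only indices 1..n of λ, μ, r, s are ever read.

rangeL : ℕ → ℕ → List ℕ
rangeL a b = go a (suc b ∸ a)
  where
  go : ℕ → ℕ → List ℕ
  go a zero    = []
  go a (suc c) = a ∷ go (suc a) c

IsPartition : ℕ → (ℕ → ℕ) → Set
IsPartition n la = ∀ i → 1 ≤ i → i < n → la (suc i) ≤ la i

Contained : ℕ → (ℕ → ℕ) → (ℕ → ℕ) → Set
Contained n mu la = ∀ i → 1 ≤ i → i ≤ n → mu i ≤ la i

WeakIncPos : ℕ → (ℕ → ℕ) → Set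
WeakIncPos n r = (∀ i → 1 ≤ i → i ≤ n → 1 ≤ r i) × (∀ i → 1 ≤ i → i < n → r i ≤ r (suc i))

minusUnit : (ℕ → ℕ) → ℕ → (ℕ → ℕ)
minusUnit s k i = if i ≡ᵇ k then s i ∸ 1 else s i

cells : ℕ → (ℕ → ℕ) → (ℕ → ℕ) → List (ℕ × ℕ)
cells n la mu = concatMap (λ i → map (λ j → (i , j)) (rangeL (suc (mu i)) (la i))) (rangeL 1 n)

-- a cell content: the list a_1, a_2, ..., a_k together with a "marked" bit
Content : Set
Content = List (ℕ × Bool)

words : ℕ → ℕ → List Content
words N zero    = [] ∷ []
words N (suc k) = concatMap (λ v → concatMap (λ b → map ((v , b) ∷_) (words N k)) (true ∷ false ∷ [])) (rangeL 1 N)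

fills : ℕ → ℕ → ℕ → List (List Content)
fills N zero    zero    = [] ∷ []
fills N zero    (suc d) = []
fills N (suc c) d = concatMap (λ k → concatMap (λ w → map (w ∷_) (fills N c (d ∸ k))) (words N k)) (rangeL 1 d)

incr : ℕ → Content → Bool
incr a []             = true
incr a ((a' , b) ∷ w) = (a ≤ᵇ a') ∧ (not b ∨ (a <ᵇ a')) ∧ incr a' w

cellOK : Content → Bool
cellOK []            = false
cellOK ((a , b) ∷ w) = not b ∧ incr a w

maxC : Content → ℕ
maxC w = foldr (λ p m → proj₁ p N.⊔ m) 0 w

minC : Content → ℕ
minC []            = 0
minC ((a , _) ∷ w) = foldr (λ p m → proj₁ p N.⊓ m) a w

Filling : Set
Filling = List ((ℕ × ℕ) × Content)

lookupCell : Filling → ℕ → ℕ → Maybe Content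
lookupCell []                    i j = nothing
lookupCell (((i' , j') , w) ∷ T) i j = if (i ≡ᵇ i') ∧ (j ≡ᵇ j') then just w else lookupCell T i j

rowCond : Content → Maybe Content → Bool
rowCond w nothing   = true
rowCond w (just w') = maxC w ≤ᵇ minC w'

colCond : Content → Maybe Content → Bool
colCond w nothing   = true
colCond w (just w') = maxC w <ᵇ minC w'

allB : {A : Set} → (A → Bool) → List A → Bool
allB p = foldr (λ a b → p a ∧ b) true

validT : (ℕ → ℕ) → (ℕ → ℕ) → Filling → Bool
validT r s T = allB ok T
  where
  ok : (ℕ × ℕ) × Content → Bool
  ok ((i , j) , w) = cellOK w ∧ (r i ≤ᵇ minC w) ∧ (maxC w ≤ᵇ s i)
                     ∧ rowCond w (lookupCell T i (suc j)) ∧ colCond w (lookupCell T (suc i) j)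

countB : Bool → Content → ℕ
countB b []            = 0
countB b ((_ , b') ∷ w) = (if b' then (if b then 1 else 0) else (if b then 0 else 1)) N.+ countB b w

sumN : List ℕ → ℕ
sumN = foldr N._+_ 0

indZ : Bool → ℤ
indZ b = if b then + 1 else + 0

-- Ring-valued part.  Formal power series in one grading variable t over R
-- (t records the x-degree: x_l is replaced by t·x_l).

module WithRing {c ℓ : Level} (R : CommutativeRing c ℓ) where
  open CommutativeRing R

  pow : Carrier → ℕ → Carrier
  pow v zero    = 1#
  pow v (suc k) = v * pow v k

  sumL : List Carrier → Carrier
  sumL = foldr _+_ 0#

  prodL : List Carrier → Carrier
  prodL = foldr _*_ 1#

  PS : Set c
  PS = ℕ → Carrier

  _≋_ : PS → PS → Set ℓ
  f ≋ g = ∀ d → f d ≈ g d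

  Σ< : ℕ → (ℕ → Carrier) → Carrier
  Σ< zero    f = 0#
  Σ< (suc m) f = Σ< m f + f m

  zeroPS : PS
  zeroPS _ = 0#

  onePS : PS
  onePS zero    = 1#
  onePS (suc _) = 0#

  addPS : PS → PS → PS
  addPS f g d = f d + g d

  negPS : PS → PS
  negPS f d = - f d

  mulPS : PS → PS → PS
  mulPS f g d = Σ< (suc d) (λ i → f i * g (d ∸ i))

  prodPS : List PS → PS
  prodPS = foldr mulPS onePS

  powPS : PS → ℕ → PS
  powPS f zero    = onePS
  powPS f (suc k) = mulPS f (powPS f k)

  geom : Carrier → PS
  geom v d = pow v d

  oneMinus : Carrier → PS
  oneMinus v zero          = 1#
  oneMinus v (suc zero)    = - v
  oneMinus v (suc (suc _)) = 0#

  -- (1 - v t)^{-c}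
  Pfac : Carrier → ℤ → PS
  Pfac v (+ k)    = powPS (geom v) k
  Pfac v -[1+ k ] = powPS (oneMinus v) (suc k)

  sumFin : ∀ {m} → (Fin m → PS) → PS
  sumFin {zero}  f = zeroPS
  sumFin {suc m} f = addPS (f F.zero) (sumFin (λ a → f (F.suc a)))

  signPS : ℕ → PS → PS
  signPS zero    p = p
  signPS (suc k) p = negPS (signPS k p)

  det : (m : ℕ) → (Fin m → Fin m → PS) → PS
  det zero    M = onePS
  det (suc m) M = sumFin (λ j → signPS (toℕ j) (mulPS (M F.zero j) (det m (λ a b → M (F.suc a) (punchIn j b)))))

  module _ (n : ℕ) (la mu r s : ℕ → ℕ) (x α β : ℕ → Carrier) where

    -- G^{row(r,s)}_{λ/μ}: coefficient of t^d = sum of wt(T) over tableaux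
    -- with d entries in total

    cellWt : (ℕ × ℕ) × Content → Carrier
    cellWt ((i , j) , w) = prodL (map (λ p → x (proj₁ p)) w)
                           * pow (α j) (countB false w ∸ 1) * pow (- β i) (countB true w)

    Grow : PS
    Grow d = sumL (map (λ Fl → let T = zip cs Fl in
                                 if validT r s T then prodL (map cellWt T) else 0#)
                       (fills Nmax (length cs) d))
      where
      cs = cells n la mu
      Nmax = sumN (map s (rangeL 1 n))

    -- h_m[X_{[a,b]}] (with x scaled by t this is the t^m coefficient)
    hX : ℕ → ℕ → ℕ → Carrier
    hX a b m = prodPS (map (λ l → Pfac (x l) (+ 1)) (rangeL a b)) m

    -- h_b[Z], Z = A_{λ_i} - A_{μ_j} - B_{i-1} + B_j
    hZ : ℕ → ℕ → ℕ → Carrier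
    hZ i j b = prodPS (map (λ l → Pfac (α l) (indZ (l ≤ᵇ la i) Z.- indZ (l ≤ᵇ mu j))) (rangeL 1 (la i N.+ mu j))
                       ++ map (λ l → Pfac (β l) (indZ (l ≤ᵇ j) Z.- indZ (l ≤ᵇ i ∸ 1))) (rangeL 1 (i N.+ j))) b

    -- h_{λ_i-μ_j-i+j}[X_{[r_j,s_i]} ⊖ Z] with x scaled by t:
    -- coefficient of t^d is h_d[X] h_{d-m}[Z] when d ≥ m, else 0
    entry : ℕ → ℕ → PS
    entry i j d = if (la i N.+ j) ≤ᵇ (d N.+ mu j N.+ i)
                  then hX (r j) (s i) d * hZ i j ((d N.+ mu j N.+ i) ∸ (la i N.+ j))
                  else 0#

    prefactor : PS
    prefactor = prodPS (concatMap (λ i → map (λ l → oneMinus (β i * x l)) (rangeL (r i) (s i))) (rangeL 1 n))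

    Gtilde : PS
    Gtilde = mulPS prefactor (det n (λ a b → entry (suc (toℕ a)) (suc (toℕ b))))

-- Tableaux: in a valid tableau every entry of row k is at most the largest entry of the cell
-- (k, λ_k), which sits directly above the cell (k+1, λ_k) and is therefore < s_{k+1} = s_k.  So
-- the bound s_k can be lowered by one without changing the set of tableaux, and if s_k = 1 the
-- cell (k, λ_k) admits no entry at all.
-- Determinant (power series in t, where t marks the x-degree): λ_k = λ_{k+1} gives
-- h[Z_{k,j}] = h[Z_{k+1,j}]/(1 − β_k t), and removing x_{s_k} from the flag multiplies h[X] by
-- 1 − x_{s_k} t.  Hence row k of the matrix for s − ε_k is (1 − β_k x_{s_k} t)·(row k) − x_{s_k} t·(row k+1)
-- of the matrix for s, so the determinant gains exactly the factor 1 − β_k x_{s_k} t that the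
-- prefactor loses.  If s_k = 1 then s_1 = … = s_{k+1} = 1, and on the columns ≥ k each of the
-- rows 1, …, k is a fixed multiple of the next one, which forces the determinant to vanish.


module Submission where

open import Defs
open import Level using (Level)
open import Algebra.Bundles using (CommutativeRing)
import Algebra.Consequences.Setoid as Consequences
import Algebra.Properties.CommutativeSemigroup as CommutativeSemigroupProperties
import Algebra.Properties.Ring as RingProperties
import Algebra.Solver.Ring.NaturalCoefficients.Default as Solver
open import Data.Bool using (Bool; true; false; if_then_else_; T; _∧_)
open import Data.Bool.Properties using (T-∧)
open import Data.Empty using (⊥-elim)
open import Data.Fin as F using (Fin; toℕ; punchIn; inject₁)
import Data.Fin.Properties as FP
open import Data.Integer as Z using (ℤ; +_; -[1+_])
import Data.Integer.Properties as ZP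
import Data.Integer.Tactic.RingSolver as ZSolver
open import Data.List using (List; []; _∷_; _++_; map; concatMap; zip; length; foldr)
open import Data.List.Properties using (map-++)
open import Data.List.Membership.Propositional using (_∈_; find; lose)
import Data.List.Membership.Propositional.Properties as ∈P
open import Data.List.Relation.Unary.Any using (Any; here; there) renaming (map to Any-map)
open import Data.Maybe using (just)
open import Data.Nat as N using (ℕ; zero; suc; _∸_; _≤_; _<_; z≤n; s≤s; _≤ᵇ_; _<ᵇ_; _≡ᵇ_; _≤?_; _<?_; _⊓_)
import Data.Nat.Properties as NP
import Algebra.Construct.Pointwise ℕ as Pointwise
open import Data.Product using (_×_; _,_; proj₁; proj₂; ∃)
open import Data.Sum using (inj₁; inj₂)
open import Data.Unit using (tt)
open import Function using (_∘_; _$_; Equivalence)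
open import Relation.Nullary using (Dec; yes; no; ¬_)
open import Relation.Binary.PropositionalEquality as P using (_≡_; _≢_)
open import Relation.Binary.Bundles using (Setoid)
open import Relation.Binary.Structures using (IsEquivalence)
import Relation.Binary.Reasoning.Setoid as SetoidReasoning

if-true : ∀ {a} {A : Set a} {b : Bool} {x y : A} → T b → (if b then x else y) ≡ x
if-true {b = true} _ = P.refl

if-false : ∀ {a} {A : Set a} {b : Bool} {x y : A} → ¬ T b → (if b then x else y) ≡ y
if-false {b = false} _  = P.refl
if-false {b = true}  ¬b = ⊥-elim (¬b tt)

T-injective : ∀ {a b : Bool} → (T a → T b) → (T b → T a) → a ≡ b
T-injective {false} {false} _ _ = P.refl
T-injective {false} {true}  _ g = ⊥-elim (g tt)
T-injective {true}  {false} f _ = ⊥-elim (f tt)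
T-injective {true}  {true}  _ _ = P.refl

≡ᵇ-refl : ∀ n → T (n ≡ᵇ n)
≡ᵇ-refl n = NP.≡⇒≡ᵇ n n P.refl

≢⇒¬≡ᵇ : ∀ {m n} → m ≢ n → ¬ T (m ≡ᵇ n)
≢⇒¬≡ᵇ {m} {n} m≢n h = m≢n (NP.≡ᵇ⇒≡ m n h)

>⇒¬≤ᵇ : ∀ {m n} → n < m → ¬ T (m ≤ᵇ n)
>⇒¬≤ᵇ {m} {n} n<m h = NP.<⇒≱ n<m (NP.≤ᵇ⇒≤ m n h)

minusUnit-≡ : ∀ s k → minusUnit s k k ≡ s k ∸ 1
minusUnit-≡ s k = if-true (≡ᵇ-refl k)

minusUnit-≢ : ∀ s k {i} → i ≢ k → minusUnit s k i ≡ s i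
minusUnit-≢ s k i≢k = if-false (≢⇒¬≡ᵇ i≢k)

minusUnit-≤ : ∀ s k i → minusUnit s k i ≤ s i
minusUnit-≤ s k i with i N.≟ k
... | yes P.refl = NP.≤-trans (NP.≤-reflexive (minusUnit-≡ s k)) (NP.m∸n≤m (s k) 1)
... | no i≢k     = NP.≤-reflexive (minusUnit-≢ s k i≢k)

IsPartition-antitone : ∀ {n la} → IsPartition n la → ∀ {i j} → 1 ≤ i → i ≤ j → j ≤ n → la j ≤ la i
IsPartition-antitone la-part {i} {zero}  1≤i i≤0 _ = ⊥-elim (NP.<⇒≱ 1≤i i≤0)
IsPartition-antitone la-part {i} {suc j} 1≤i i≤1+j 1+j≤n with i N.≟ suc j
... | yes P.refl = NP.≤-refl
... | no i≢1+j   = NP.≤-trans (la-part j (NP.≤-trans 1≤i i≤j) 1+j≤n)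
                              (IsPartition-antitone la-part 1≤i i≤j (NP.≤-trans (NP.n≤1+n j) 1+j≤n))
  where
  i≤j : i ≤ j
  i≤j = NP.≤-pred (NP.≤∧≢⇒< i≤1+j i≢1+j)

WeakIncPos-monotone : ∀ {n r} → WeakIncPos n r → ∀ {i j} → 1 ≤ i → i ≤ j → j ≤ n → r i ≤ r j
WeakIncPos-monotone r-inc {i} {zero}  1≤i i≤0 _ = ⊥-elim (NP.<⇒≱ 1≤i i≤0)
WeakIncPos-monotone r-inc {i} {suc j} 1≤i i≤1+j 1+j≤n with i N.≟ suc j
... | yes P.refl = NP.≤-refl
... | no i≢1+j   = NP.≤-trans (WeakIncPos-monotone r-inc 1≤i i≤j (NP.≤-trans (NP.n≤1+n j) 1+j≤n))
                              (proj₂ r-inc j (NP.≤-trans 1≤i i≤j) 1+j≤n)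
  where
  i≤j : i ≤ j
  i≤j = NP.≤-pred (NP.≤∧≢⇒< i≤1+j i≢1+j)

rangeL-nil : ∀ {a b} → b < a → rangeL a b ≡ []
rangeL-nil b<a rewrite NP.m≤n⇒m∸n≡0 b<a = P.refl

rangeL-cons : ∀ {a b} → a ≤ b → rangeL a b ≡ a ∷ rangeL (suc a) b
rangeL-cons a≤b rewrite NP.+-∸-assoc 1 a≤b = P.refl

rangeL-snoc : ∀ {a b} → a ≤ suc b → rangeL a (suc b) ≡ rangeL a b ++ (suc b ∷ [])
rangeL-snoc {a} {b} a≤1+b = go (suc b ∸ a) (NP.m∸n+n≡m a≤1+b)
  where
  go : ∀ {a} d → d N.+ a ≡ suc b → rangeL a (suc b) ≡ rangeL a b ++ (suc b ∷ [])
  go zero P.refl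
    rewrite rangeL-nil (NP.n<1+n b) | rangeL-cons (NP.≤-refl {suc b}) | rangeL-nil (NP.n<1+n (suc b)) = P.refl
  go {a} (suc d) e
    rewrite rangeL-cons {a} {suc b} (NP.≤-trans (NP.m≤n+m a (suc d)) (NP.≤-reflexive e))
          | rangeL-cons {a} {b} (NP.≤-pred (NP.≤-trans (NP.m≤n+m (suc a) d) (NP.≤-reflexive (P.trans (NP.+-suc d a) e))))
          | go d (P.trans (NP.+-suc d a) e) = P.refl

∈-rangeL⁻ : ∀ {a b i} → i ∈ rangeL a b → a ≤ i × i ≤ b
∈-rangeL⁻ {zero}  {zero} (here P.refl) = z≤n , z≤n
∈-rangeL⁻ {suc a} {zero} i∈ rewrite rangeL-nil {suc a} {zero} (s≤s z≤n) with i∈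
... | ()
∈-rangeL⁻ {a} {suc b} {i} i∈ with a ≤? suc b
... | no a≰1+b rewrite rangeL-nil (NP.≰⇒> a≰1+b) with i∈
...   | ()
∈-rangeL⁻ {a} {suc b} {i} i∈ | yes a≤1+b rewrite rangeL-snoc a≤1+b with ∈P.∈-++⁻ (rangeL a b) i∈
... | inj₁ i∈′ = let a≤i , i≤b = ∈-rangeL⁻ i∈′ in a≤i , NP.m≤n⇒m≤1+n i≤b
... | inj₂ (here P.refl) = a≤1+b , NP.≤-refl

∈-rangeL⁺ : ∀ {a b i} → a ≤ i → i ≤ b → i ∈ rangeL a b
∈-rangeL⁺ {a} {zero}  {zero} z≤n z≤n = here P.refl
∈-rangeL⁺ {a} {suc b} {i} a≤i i≤1+b rewrite rangeL-snoc (NP.≤-trans a≤i i≤1+b) with i N.≟ suc b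
... | yes P.refl = ∈P.∈-++⁺ʳ (rangeL a b) (here P.refl)
... | no i≢1+b   = ∈P.∈-++⁺ˡ (∈-rangeL⁺ a≤i (NP.≤-pred (NP.≤∧≢⇒< i≤1+b i≢1+b)))

module PowerSeries {c ℓ} (R : CommutativeRing c ℓ) where

  open CommutativeRing R
  open WithRing R
  open RingProperties ring using (-‿distribˡ-*)
  open SetoidReasoning setoid
  open CommutativeSemigroupProperties +-commutativeSemigroup using () renaming (interchange to +-interchange)
  open CommutativeSemigroupProperties *-commutativeSemigroup using (x∙yz≈y∙xz) renaming (interchange to *-interchange)

  Σ<-cong : ∀ n {f g : ℕ → Carrier} → (∀ i → i < n → f i ≈ g i) → Σ< n f ≈ Σ< n g
  Σ<-cong zero    f≈g = refl
  Σ<-cong (suc n) f≈g = +-cong (Σ<-cong n (λ i i<n → f≈g i (NP.m<n⇒m<1+n i<n))) (f≈g n (NP.n<1+n n))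

  Σ<-zero : ∀ n {f : ℕ → Carrier} → (∀ i → i < n → f i ≈ 0#) → Σ< n f ≈ 0#
  Σ<-zero zero    f≈0 = refl
  Σ<-zero (suc n) f≈0 =
    trans (+-cong (Σ<-zero n (λ i i<n → f≈0 i (NP.m<n⇒m<1+n i<n))) (f≈0 n (NP.n<1+n n))) (+-identityʳ 0#)

  Σ<-distrib-+ : ∀ n (f g : ℕ → Carrier) → Σ< n (λ i → f i + g i) ≈ Σ< n f + Σ< n g
  Σ<-distrib-+ zero    f g = sym (+-identityˡ 0#)
  Σ<-distrib-+ (suc n) f g = trans (+-congʳ (Σ<-distrib-+ n f g)) (+-interchange _ _ _ _)

  *-distribˡ-Σ< : ∀ n a (f : ℕ → Carrier) → a * Σ< n f ≈ Σ< n (λ i → a * f i)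
  *-distribˡ-Σ< zero    a f = zeroʳ a
  *-distribˡ-Σ< (suc n) a f = trans (distribˡ a _ _) (+-congʳ (*-distribˡ-Σ< n a f))

  *-distribʳ-Σ< : ∀ n a (f : ℕ → Carrier) → Σ< n f * a ≈ Σ< n (λ i → f i * a)
  *-distribʳ-Σ< zero    a f = zeroˡ a
  *-distribʳ-Σ< (suc n) a f = trans (distribʳ a _ _) (+-congʳ (*-distribʳ-Σ< n a f))

  Σ<-head : ∀ n (f : ℕ → Carrier) → Σ< (suc n) f ≈ f 0 + Σ< n (λ i → f (suc i))
  Σ<-head zero    f = trans (+-identityˡ _) (sym (+-identityʳ _))
  Σ<-head (suc n) f = trans (+-congʳ (Σ<-head n f)) (+-assoc _ _ _)

  Σ<-reverse : ∀ n (f : ℕ → Carrier) → Σ< n f ≈ Σ< n (λ i → f (n ∸ suc i))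
  Σ<-reverse zero    f = refl
  Σ<-reverse (suc n) f = begin
    Σ< n f + f n                      ≈⟨ +-congʳ (Σ<-reverse n f) ⟩
    Σ< n (λ i → f (n ∸ suc i)) + f n  ≈⟨ +-comm _ _ ⟩
    f n + Σ< n (λ i → f (n ∸ suc i))  ≈⟨ Σ<-head n (λ i → f (n ∸ i)) ⟨
    Σ< (suc n) (λ i → f (n ∸ i))      ∎

  Σ<-triangle : ∀ d (F : ℕ → ℕ → Carrier) →
    Σ< (suc d) (λ i → Σ< (suc i) (λ a → F a i)) ≈ Σ< (suc d) (λ a → Σ< (suc (d ∸ a)) (λ j → F a (a N.+ j)))
  Σ<-triangle zero    F = refl
  Σ<-triangle (suc d) F = begin
    Σ< (suc d) (λ i → Σ< (suc i) (λ a → F a i)) + (Σ< (suc d) (λ a → F a (suc d)) + F (suc d) (suc d))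
      ≈⟨ +-congʳ (Σ<-triangle d F) ⟩
    Σ< (suc d) rows + (Σ< (suc d) (λ a → F a (suc d)) + F (suc d) (suc d))
      ≈⟨ +-assoc _ _ _ ⟨
    (Σ< (suc d) rows + Σ< (suc d) (λ a → F a (suc d))) + F (suc d) (suc d)
      ≈⟨ +-cong (sym (trans (Σ<-cong (suc d) longer) (Σ<-distrib-+ (suc d) rows (λ a → F a (suc d))))) corner ⟩
    Σ< (suc d) rows′ + Σ< (suc (d ∸ d)) (λ j → F (suc d) (suc d N.+ j)) ∎
    where
    rows rows′ : ℕ → Carrier
    rows  a = Σ< (suc (d ∸ a)) (λ j → F a (a N.+ j))
    rows′ a = Σ< (suc (suc d ∸ a)) (λ j → F a (a N.+ j))
    corner : F (suc d) (suc d) ≈ Σ< (suc (d ∸ d)) (λ j → F (suc d) (suc d N.+ j))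
    corner rewrite NP.n∸n≡0 d | NP.+-identityʳ d = sym (+-identityˡ _)
    longer : ∀ a → a < suc d → rows′ a ≈ rows a + F a (suc d)
    longer a (s≤s a≤d) rewrite NP.+-∸-assoc 1 a≤d =
      +-congˡ (reflexive (P.cong (F a) (P.trans (NP.+-suc a (d ∸ a)) (P.cong suc (NP.m+[n∸m]≡n a≤d)))))

  mulPS-cong : ∀ {f f′ g g′} → f ≋ f′ → g ≋ g′ → mulPS f g ≋ mulPS f′ g′
  mulPS-cong f≋f′ g≋g′ d = Σ<-cong (suc d) (λ i _ → *-cong (f≋f′ i) (g≋g′ (d ∸ i)))

  mulPS-comm : ∀ f g → mulPS f g ≋ mulPS g f
  mulPS-comm f g d = begin
    Σ< (suc d) (λ i → f i * g (d ∸ i))              ≈⟨ Σ<-reverse (suc d) _ ⟩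
    Σ< (suc d) (λ i → f (d ∸ i) * g (d ∸ (d ∸ i)))  ≈⟨ Σ<-cong (suc d) swap ⟩
    Σ< (suc d) (λ i → g i * f (d ∸ i))              ∎
    where
    swap : ∀ i → i < suc d → f (d ∸ i) * g (d ∸ (d ∸ i)) ≈ g i * f (d ∸ i)
    swap i (s≤s i≤d) rewrite NP.m∸[m∸n]≡n i≤d = *-comm _ _

  mulPS-assoc : ∀ f g h → mulPS (mulPS f g) h ≋ mulPS f (mulPS g h)
  mulPS-assoc f g h d = begin
    Σ< (suc d) (λ i → Σ< (suc i) (λ a → f a * g (i ∸ a)) * h (d ∸ i))
      ≈⟨ Σ<-cong (suc d) (λ i _ → *-distribʳ-Σ< (suc i) _ _) ⟩
    Σ< (suc d) (λ i → Σ< (suc i) (λ a → f a * g (i ∸ a) * h (d ∸ i)))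
      ≈⟨ Σ<-triangle d (λ a i → f a * g (i ∸ a) * h (d ∸ i)) ⟩
    Σ< (suc d) (λ a → Σ< (suc (d ∸ a)) (λ j → f a * g ((a N.+ j) ∸ a) * h (d ∸ (a N.+ j))))
      ≈⟨ Σ<-cong (suc d) (λ a _ → Σ<-cong (suc (d ∸ a)) (λ j _ → reindex a j)) ⟩
    Σ< (suc d) (λ a → Σ< (suc (d ∸ a)) (λ j → f a * (g j * h ((d ∸ a) ∸ j))))
      ≈⟨ Σ<-cong (suc d) (λ a _ → sym (*-distribˡ-Σ< (suc (d ∸ a)) _ _)) ⟩
    Σ< (suc d) (λ a → f a * Σ< (suc (d ∸ a)) (λ j → g j * h ((d ∸ a) ∸ j))) ∎
    where
    reindex : ∀ a j → f a * g ((a N.+ j) ∸ a) * h (d ∸ (a N.+ j)) ≈ f a * (g j * h ((d ∸ a) ∸ j))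
    reindex a j rewrite NP.m+n∸m≡n a j | NP.∸-+-assoc d a j = *-assoc _ _ _

  mulPS-distribˡ : ∀ f g h → mulPS f (addPS g h) ≋ addPS (mulPS f g) (mulPS f h)
  mulPS-distribˡ f g h d = trans (Σ<-cong (suc d) (λ i _ → distribˡ _ _ _)) (Σ<-distrib-+ (suc d) _ _)

  mulPS-identityˡ : ∀ f → mulPS onePS f ≋ f
  mulPS-identityˡ f d = begin
    Σ< (suc d) (λ i → onePS i * f (d ∸ i))               ≈⟨ Σ<-head d _ ⟩
    1# * f d + Σ< d (λ i → 0# * f (d ∸ suc i))           ≈⟨ +-cong (*-identityˡ _) (Σ<-zero d (λ i _ → zeroˡ _)) ⟩
    f d + 0#                                              ≈⟨ +-identityʳ _ ⟩
    f d                                                   ∎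

  ≋-isEquivalence : IsEquivalence _≋_
  ≋-isEquivalence = Pointwise.isEquivalence isEquivalence

  ≋-setoid : Setoid c ℓ
  ≋-setoid = record { isEquivalence = ≋-isEquivalence }

  PSR : CommutativeRing c ℓ
  PSR = record
    { _≈_ = _≋_ ; _+_ = addPS ; _*_ = mulPS ; -_ = negPS ; 0# = zeroPS ; 1# = onePS
    ; isCommutativeRing = record
      { isRing = record
        { +-isAbelianGroup = Pointwise.isAbelianGroup +-isAbelianGroup
        ; *-cong           = mulPS-cong
        ; *-assoc          = mulPS-assoc
        ; *-identity       = comm∧idˡ⇒id mulPS-comm mulPS-identityˡ
        ; distrib          = comm∧distrˡ⇒distr (λ f≋f′ g≋g′ d → +-cong (f≋f′ d) (g≋g′ d)) mulPS-comm mulPS-distribˡ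
        }
      ; *-comm = mulPS-comm
      }
    }
    where
    open Consequences ≋-setoid

  module PS = CommutativeRing PSR
  module PSSolver = Solver PS.commutativeSemiring
  open RingProperties PS.ring public using () renaming (-‿distribˡ-* to negPS-distribˡ-mulPS)

  ≡⇒≋ : ∀ {f g : PS} → f ≡ g → f ≋ g
  ≡⇒≋ P.refl _ = refl

  mulPS-identityʳ : ∀ f → mulPS f onePS ≋ f
  mulPS-identityʳ = PS.*-identityʳ

  mulPS-congˡ : ∀ f {g g′} → g ≋ g′ → mulPS f g ≋ mulPS f g′
  mulPS-congˡ f g≋g′ d = Σ<-cong (suc d) (λ i _ → *-congˡ (g≋g′ (d ∸ i)))

  mulPS-congʳ : ∀ g {f f′} → f ≋ f′ → mulPS f g ≋ mulPS f′ g
  mulPS-congʳ g f≋f′ d = Σ<-cong (suc d) (λ i _ → *-congʳ (f≋f′ i))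

  oneMinus-*-zero : ∀ v f → mulPS (oneMinus v) f 0 ≈ f 0
  oneMinus-*-zero v f = trans (+-identityˡ _) (*-identityˡ _)

  oneMinus-*-suc : ∀ v f d → mulPS (oneMinus v) f (suc d) ≈ f (suc d) + - (v * f d)
  oneMinus-*-suc v f d = begin
    Σ< (suc (suc d)) (λ i → oneMinus v i * f (suc d ∸ i))
      ≈⟨ Σ<-head (suc d) _ ⟩
    1# * f (suc d) + Σ< (suc d) (λ i → oneMinus v (suc i) * f (d ∸ i))
      ≈⟨ +-cong (*-identityˡ _) (Σ<-head d _) ⟩
    f (suc d) + (- v * f d + Σ< d (λ i → 0# * f (d ∸ suc i)))
      ≈⟨ +-congˡ (trans (+-congˡ (Σ<-zero d (λ i _ → zeroˡ _))) (+-identityʳ _)) ⟩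
    f (suc d) + - v * f d
      ≈⟨ +-congˡ (-‿distribˡ-* v (f d)) ⟨
    f (suc d) + - (v * f d) ∎

  geom-*-suc : ∀ v f d → mulPS (geom v) f (suc d) ≈ f (suc d) + v * mulPS (geom v) f d
  geom-*-suc v f d = begin
    mulPS (geom v) f (suc d)
      ≈⟨ mulPS-comm (geom v) f (suc d) ⟩
    Σ< (suc d) (λ i → f i * pow v (suc d ∸ i)) + f (suc d) * pow v (suc d ∸ suc d)
      ≈⟨ +-cong (Σ<-cong (suc d) lower) (trans (*-congˡ (reflexive (P.cong (pow v) (NP.n∸n≡0 d)))) (*-identityʳ _)) ⟩
    Σ< (suc d) (λ i → v * (f i * pow v (d ∸ i))) + f (suc d)
      ≈⟨ +-comm _ _ ⟩
    f (suc d) + Σ< (suc d) (λ i → v * (f i * pow v (d ∸ i)))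
      ≈⟨ +-congˡ (trans (*-congˡ (mulPS-comm (geom v) f d)) (*-distribˡ-Σ< (suc d) v _)) ⟨
    f (suc d) + v * mulPS (geom v) f d ∎
    where
    lower : ∀ i → i < suc d → f i * pow v (suc d ∸ i) ≈ v * (f i * pow v (d ∸ i))
    lower i (s≤s i≤d) rewrite NP.+-∸-assoc 1 i≤d = x∙yz≈y∙xz (f i) v _

  geom-*-oneMinus : ∀ v → mulPS (geom v) (oneMinus v) ≋ onePS
  geom-*-oneMinus v zero    = trans (mulPS-comm (geom v) (oneMinus v) 0) (oneMinus-*-zero v (geom v))
  geom-*-oneMinus v (suc d) =
    trans (mulPS-comm (geom v) (oneMinus v) (suc d)) (trans (oneMinus-*-suc v (geom v) d) (-‿inverseʳ _))

  monomial : Carrier → ℕ → PS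
  monomial v a d = if d ≡ᵇ a then v else 0#

  monomial-*-≥ : ∀ v a f {d} → a ≤ d → mulPS (monomial v a) f d ≈ v * f (d ∸ a)
  monomial-*-≥ v a f {d} a≤d = pick (suc d) (s≤s a≤d)
    where
    pick : ∀ n → a < n → Σ< n (λ i → monomial v a i * f (d ∸ i)) ≈ v * f (d ∸ a)
    pick (suc n) a<1+n with a N.≟ n
    ... | yes P.refl = begin
      Σ< a (λ i → monomial v a i * f (d ∸ i)) + monomial v a a * f (d ∸ a)
        ≈⟨ +-cong (Σ<-zero a (λ i i<a → trans (*-congʳ (reflexive (if-false (≢⇒¬≡ᵇ (NP.<⇒≢ i<a))))) (zeroˡ _)))
                  (*-congʳ (reflexive (if-true (≡ᵇ-refl a)))) ⟩
      0# + v * f (d ∸ a) ≈⟨ +-identityˡ _ ⟩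
      v * f (d ∸ a)      ∎
    ... | no a≢n = begin
      Σ< n (λ i → monomial v a i * f (d ∸ i)) + monomial v a n * f (d ∸ n)
        ≈⟨ +-cong (pick n (NP.≤∧≢⇒< (NP.≤-pred a<1+n) a≢n))
                  (trans (*-congʳ (reflexive (if-false (≢⇒¬≡ᵇ (a≢n ∘ P.sym))))) (zeroˡ _)) ⟩
      v * f (d ∸ a) + 0# ≈⟨ +-identityʳ _ ⟩
      v * f (d ∸ a)      ∎

  monomial-*-< : ∀ v a f {d} → d < a → mulPS (monomial v a) f d ≈ 0#
  monomial-*-< v a f {d} d<a = Σ<-zero (suc d) (λ i i<1+d →
    trans (*-congʳ (reflexive (if-false (≢⇒¬≡ᵇ (NP.<⇒≢ (NP.<-≤-trans i<1+d d<a)))))) (zeroˡ _))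

  monomial-+ : ∀ a b → monomial 1# (a N.+ b) ≋ mulPS (monomial 1# a) (monomial 1# b)
  monomial-+ a b d with a ≤? d
  ... | no a≰d = trans (reflexive (if-false (≢⇒¬≡ᵇ λ d≡a+b → a≰d (P.subst (a ≤_) (P.sym d≡a+b) (NP.m≤m+n a b)))))
                       (sym (monomial-*-< 1# a (monomial 1# b) (NP.≰⇒> a≰d)))
  ... | yes a≤d = trans (reflexive same) (sym (trans (monomial-*-≥ 1# a (monomial 1# b) a≤d) (*-identityˡ _)))
    where
    same : monomial 1# (a N.+ b) d ≡ monomial 1# b (d ∸ a)
    same with d ∸ a N.≟ b
    ... | yes d∸a≡b = P.trans (if-true (NP.≡⇒≡ᵇ d (a N.+ b) (P.trans (P.sym (NP.m+[n∸m]≡n a≤d)) (P.cong (a N.+_) d∸a≡b))))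
                              (P.sym (if-true (NP.≡⇒≡ᵇ _ _ d∸a≡b)))
    ... | no d∸a≢b  = P.trans (if-false (≢⇒¬≡ᵇ λ d≡a+b → d∸a≢b (P.trans (P.cong (_∸ a) d≡a+b) (NP.m+n∸m≡n a b))))
                              (P.sym (if-false (≢⇒¬≡ᵇ d∸a≢b)))

  monomial-drop : ∀ m C′ f d → mulPS (monomial 1# (m N.+ C′)) f (C′ N.+ d) ≈ mulPS (monomial 1# m) f d
  monomial-drop m C′ f d with m ≤? d
  ... | yes m≤d = begin
    mulPS (monomial 1# (m N.+ C′)) f (C′ N.+ d)  ≈⟨ monomial-*-≥ 1# (m N.+ C′) f (P.subst (_≤ C′ N.+ d) (NP.+-comm C′ m) (NP.+-monoʳ-≤ C′ m≤d)) ⟩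
    1# * f (C′ N.+ d ∸ (m N.+ C′))                ≈⟨ *-congˡ (reflexive (P.cong f cancel)) ⟩
    1# * f (d ∸ m)                                ≈⟨ monomial-*-≥ 1# m f m≤d ⟨
    mulPS (monomial 1# m) f d                     ∎
    where
    cancel : C′ N.+ d ∸ (m N.+ C′) ≡ d ∸ m
    cancel = P.trans (P.cong (C′ N.+ d ∸_) (NP.+-comm m C′)) (NP.[m+n]∸[m+o]≡n∸o C′ d m)
  ... | no m≰d = trans (monomial-*-< 1# (m N.+ C′) f (P.subst (C′ N.+ d <_) (NP.+-comm C′ m) (NP.+-monoʳ-< C′ (NP.≰⇒> m≰d))))
                       (sym (monomial-*-< 1# m f (NP.≰⇒> m≰d)))

  pow-+ : ∀ y a b → pow y (a N.+ b) ≈ pow y a * pow y b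
  pow-+ y zero    b = sym (*-identityˡ _)
  pow-+ y (suc a) b = trans (*-congˡ (pow-+ y a b)) (sym (*-assoc _ _ _))

  scale : Carrier → PS → PS
  scale y f d = pow y d * f d

  scale-cong : ∀ y {f g} → f ≋ g → scale y f ≋ scale y g
  scale-cong y f≋g d = *-congˡ (f≋g d)

  scale-mulPS : ∀ y f g → scale y (mulPS f g) ≋ mulPS (scale y f) (scale y g)
  scale-mulPS y f g d = trans (*-distribˡ-Σ< (suc d) (pow y d) _) (Σ<-cong (suc d) split)
    where
    split : ∀ i → i < suc d → pow y d * (f i * g (d ∸ i)) ≈ pow y i * f i * (pow y (d ∸ i) * g (d ∸ i))
    split i (s≤s i≤d) = begin
      pow y d * (f i * g (d ∸ i))                        ≈⟨ *-congʳ (reflexive (P.cong (pow y) (P.sym (NP.m+[n∸m]≡n i≤d)))) ⟩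
      pow y (i N.+ (d ∸ i)) * (f i * g (d ∸ i))          ≈⟨ *-congʳ (pow-+ y i (d ∸ i)) ⟩
      (pow y i * pow y (d ∸ i)) * (f i * g (d ∸ i))      ≈⟨ *-interchange _ _ _ _ ⟩
      pow y i * f i * (pow y (d ∸ i) * g (d ∸ i))        ∎

  prodPS-map-const-term : ∀ {A : Set} (L : List A) (f : A → PS) → (∀ a → f a 0 ≈ 1#) → prodPS (map f L) 0 ≈ 1#
  prodPS-map-const-term []      f f₀≈1 = refl
  prodPS-map-const-term (a ∷ L) f f₀≈1 =
    trans (+-identityˡ _) (trans (*-cong (f₀≈1 a) (prodPS-map-const-term L f f₀≈1)) (*-identityˡ 1#))

module PowerSeriesProducts {c ℓ} (R : CommutativeRing c ℓ) where

  open WithRing R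
  open PowerSeries R
  open SetoidReasoning PS.setoid
  open CommutativeSemigroupProperties PS.*-commutativeSemigroup using (xy∙z≈xz∙y) renaming (interchange to *-interchange)

  Pfac-1+ : ∀ v e → Pfac v (Z.1ℤ Z.+ e) ≋ mulPS (geom v) (Pfac v e)
  Pfac-1+ v (+ n)           = PS.refl
  Pfac-1+ v -[1+ zero ]     = PS.sym (PS.trans (mulPS-congˡ (geom v) (mulPS-identityʳ (oneMinus v))) (geom-*-oneMinus v))
  Pfac-1+ v -[1+ suc n ]    = PS.sym (PS.trans (PS.sym (PS.*-assoc (geom v) (oneMinus v) (Pfac v -[1+ n ])))
                                 (PS.trans (mulPS-congʳ (Pfac v -[1+ n ]) (geom-*-oneMinus v)) (PS.*-identityˡ (Pfac v -[1+ n ]))))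

  Pfac-1- : ∀ v e → Pfac v (Z.-1ℤ Z.+ e) ≋ mulPS (oneMinus v) (Pfac v e)
  Pfac-1- v (+ zero)    = PS.refl
  Pfac-1- v (+ suc n)   = PS.sym (PS.trans (PS.sym (PS.*-assoc (oneMinus v) (geom v) (Pfac v (+ n))))
                            (PS.trans (mulPS-congʳ (Pfac v (+ n)) (PS.trans (PS.*-comm (oneMinus v) (geom v)) (geom-*-oneMinus v)))
                                      (PS.*-identityˡ (Pfac v (+ n)))))
  Pfac-1- v -[1+ n ]    = PS.refl

  Pfac-+ : ∀ v a b → Pfac v (a Z.+ b) ≋ mulPS (Pfac v a) (Pfac v b)
  Pfac-+ v (+ zero) b rewrite ZP.+-identityˡ b = PS.sym (PS.*-identityˡ (Pfac v b))
  Pfac-+ v (+ suc n) b = P.subst (λ e → Pfac v e ≋ mulPS (Pfac v (+ suc n)) (Pfac v b)) (P.sym (ZP.+-assoc Z.1ℤ (+ n) b)) $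
    PS.trans (Pfac-1+ v (+ n Z.+ b))
      (PS.trans (mulPS-congˡ (geom v) (Pfac-+ v (+ n) b)) (PS.sym (PS.*-assoc (geom v) (Pfac v (+ n)) (Pfac v b))))
  Pfac-+ v -[1+ zero ] b = PS.trans (Pfac-1- v b) (mulPS-congʳ (Pfac v b) (PS.sym (mulPS-identityʳ (oneMinus v))))
  Pfac-+ v -[1+ suc n ] b = P.subst (λ e → Pfac v e ≋ mulPS (Pfac v -[1+ suc n ]) (Pfac v b)) (P.sym (ZP.+-assoc Z.-1ℤ -[1+ n ] b)) $
    PS.trans (Pfac-1- v (-[1+ n ] Z.+ b))
      (PS.trans (mulPS-congˡ (oneMinus v) (Pfac-+ v -[1+ n ] b)) (PS.sym (PS.*-assoc (oneMinus v) (Pfac v -[1+ n ]) (Pfac v b))))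

  prodPS-++ : ∀ (fs gs : List PS) → prodPS (fs ++ gs) ≋ mulPS (prodPS fs) (prodPS gs)
  prodPS-++ []       gs = PS.sym (PS.*-identityˡ (prodPS gs))
  prodPS-++ (f ∷ fs) gs = PS.trans (mulPS-congˡ f (prodPS-++ fs gs)) (PS.sym (PS.*-assoc f (prodPS fs) (prodPS gs)))

  prodPS-map-cong : ∀ {A : Set} (L : List A) {f g : A → PS} → (∀ a → a ∈ L → f a ≋ g a) →
                    prodPS (map f L) ≋ prodPS (map g L)
  prodPS-map-cong []      f≋g = PS.refl
  prodPS-map-cong (a ∷ L) f≋g = PS.*-cong (f≋g a (here P.refl)) (prodPS-map-cong L (λ b b∈L → f≋g b (there b∈L)))

  prodPS-map-* : ∀ {A : Set} (L : List A) (f g : A → PS) →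
                 prodPS (map (λ a → mulPS (f a) (g a)) L) ≋ mulPS (prodPS (map f L)) (prodPS (map g L))
  prodPS-map-* []      f g = PS.sym (PS.*-identityˡ onePS)
  prodPS-map-* (a ∷ L) f g = PS.trans (mulPS-congˡ (mulPS (f a) (g a)) (prodPS-map-* L f g))
                                      (*-interchange (f a) (g a) (prodPS (map f L)) (prodPS (map g L)))

  prodPS-concatMap : ∀ {A : Set} (F : A → List PS) (L : List A) →
                     prodPS (concatMap F L) ≋ prodPS (map (λ a → prodPS (F a)) L)
  prodPS-concatMap F []      = PS.refl
  prodPS-concatMap F (a ∷ L) = PS.trans (prodPS-++ (F a) (concatMap F L)) (mulPS-congˡ (prodPS (F a)) (prodPS-concatMap F L))

  prodPS-rangeL-snoc : ∀ (g : ℕ → PS) {a b} → a ≤ suc b →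
                       prodPS (map g (rangeL a (suc b))) ≋ mulPS (prodPS (map g (rangeL a b))) (g (suc b))
  prodPS-rangeL-snoc g {a} {b} a≤1+b rewrite rangeL-snoc a≤1+b | map-++ g (rangeL a b) (suc b ∷ []) =
    PS.trans (prodPS-++ (map g (rangeL a b)) (g (suc b) ∷ [])) (mulPS-congˡ (prodPS (map g (rangeL a b))) (mulPS-identityʳ (g (suc b))))

  prodPS-rangeL-update : ∀ (g g′ : ℕ → PS) u {k} → (∀ i → i ≢ k → g i ≋ g′ i) → g k ≋ mulPS (g′ k) u →
                         ∀ {N} → 1 ≤ k → k ≤ N →
                         prodPS (map g (rangeL 1 N)) ≋ mulPS (prodPS (map g′ (rangeL 1 N))) u
  prodPS-rangeL-update g g′ u g≋g′ gk≋g′ku {zero} 1≤k k≤0 = ⊥-elim (NP.<⇒≱ 1≤k k≤0)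
  prodPS-rangeL-update g g′ u {k} g≋g′ gk≋g′ku {suc N} 1≤k k≤1+N with k N.≟ suc N
  ... | yes P.refl = begin
    prodPS (map g (rangeL 1 (suc N)))                  ≈⟨ prodPS-rangeL-snoc g (s≤s z≤n) ⟩
    mulPS (prodPS (map g (rangeL 1 N))) (g (suc N))    ≈⟨ PS.*-cong below gk≋g′ku ⟩
    mulPS (prodPS (map g′ (rangeL 1 N))) (mulPS (g′ (suc N)) u)  ≈⟨ PS.*-assoc (prodPS (map g′ (rangeL 1 N))) (g′ (suc N)) u ⟨
    mulPS (mulPS (prodPS (map g′ (rangeL 1 N))) (g′ (suc N))) u  ≈⟨ mulPS-congʳ u (prodPS-rangeL-snoc g′ (s≤s z≤n)) ⟨
    mulPS (prodPS (map g′ (rangeL 1 (suc N)))) u       ∎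
    where
    below : prodPS (map g (rangeL 1 N)) ≋ prodPS (map g′ (rangeL 1 N))
    below = prodPS-map-cong (rangeL 1 N) (λ i i∈ → g≋g′ i (NP.<⇒≢ (s≤s (proj₂ (∈-rangeL⁻ i∈)))))
  ... | no k≢1+N = begin
    prodPS (map g (rangeL 1 (suc N)))                  ≈⟨ prodPS-rangeL-snoc g (s≤s z≤n) ⟩
    mulPS (prodPS (map g (rangeL 1 N))) (g (suc N))    ≈⟨ PS.*-cong earlier (g≋g′ (suc N) (k≢1+N ∘ P.sym)) ⟩
    mulPS (mulPS (prodPS (map g′ (rangeL 1 N))) u) (g′ (suc N))  ≈⟨ xy∙z≈xz∙y (prodPS (map g′ (rangeL 1 N))) u (g′ (suc N)) ⟩
    mulPS (mulPS (prodPS (map g′ (rangeL 1 N))) (g′ (suc N))) u  ≈⟨ mulPS-congʳ u (prodPS-rangeL-snoc g′ (s≤s z≤n)) ⟨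
    mulPS (prodPS (map g′ (rangeL 1 (suc N)))) u       ∎
    where
    earlier : prodPS (map g (rangeL 1 N)) ≋ mulPS (prodPS (map g′ (rangeL 1 N))) u
    earlier = prodPS-rangeL-update g g′ u g≋g′ gk≋g′ku 1≤k (NP.≤-pred (NP.≤∧≢⇒< k≤1+N k≢1+N))

module Determinant {c ℓ} (S : CommutativeRing c ℓ) where

  open CommutativeRing S
  open RingProperties ring using (-‿distribʳ-*; -‿involutive; -0#≈0#; -‿+-comm)
  open CommutativeSemigroupProperties +-commutativeSemigroup using () renaming (interchange to +-interchange)
  open CommutativeSemigroupProperties *-commutativeSemigroup using (x∙yz≈y∙xz)
  open SetoidReasoning setoid

  sumFin : ∀ {m} → (Fin m → Carrier) → Carrier
  sumFin {zero}  f = 0#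
  sumFin {suc m} f = f F.zero + sumFin (λ a → f (F.suc a))

  signPS : ℕ → Carrier → Carrier
  signPS zero    p = p
  signPS (suc k) p = - signPS k p

  minor : ∀ {m} → (Fin (suc m) → Fin (suc m) → Carrier) → Fin (suc m) → Fin m → Fin m → Carrier
  minor M j a b = M (F.suc a) (punchIn j b)

  det : (m : ℕ) → (Fin m → Fin m → Carrier) → Carrier
  det zero    M = 1#
  det (suc m) M = sumFin (λ j → signPS (toℕ j) (M F.zero j * det m (minor M j)))

  sumFin-cong : ∀ {m} {f g : Fin m → Carrier} → (∀ j → f j ≈ g j) → sumFin f ≈ sumFin g
  sumFin-cong {zero}  f≈g = refl
  sumFin-cong {suc m} f≈g = +-cong (f≈g F.zero) (sumFin-cong (f≈g ∘ F.suc))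

  sumFin-zero : ∀ {m} {f : Fin m → Carrier} → (∀ j → f j ≈ 0#) → sumFin f ≈ 0#
  sumFin-zero {zero}  f≈0 = refl
  sumFin-zero {suc m} f≈0 = trans (+-cong (f≈0 F.zero) (sumFin-zero (f≈0 ∘ F.suc))) (+-identityˡ 0#)

  sumFin-distrib-+ : ∀ {m} (f g : Fin m → Carrier) → sumFin (λ j → f j + g j) ≈ sumFin f + sumFin g
  sumFin-distrib-+ {zero}  f g = sym (+-identityˡ 0#)
  sumFin-distrib-+ {suc m} f g = trans (+-congˡ (sumFin-distrib-+ (f ∘ F.suc) (g ∘ F.suc))) (+-interchange _ _ _ _)

  *-distribˡ-sumFin : ∀ {m} q (f : Fin m → Carrier) → q * sumFin f ≈ sumFin (λ j → q * f j)
  *-distribˡ-sumFin {zero}  q f = zeroʳ q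
  *-distribˡ-sumFin {suc m} q f = trans (distribˡ q _ _) (+-congˡ (*-distribˡ-sumFin q (f ∘ F.suc)))

  -‿distrib-sumFin : ∀ {m} (f : Fin m → Carrier) → - sumFin f ≈ sumFin (λ j → - f j)
  -‿distrib-sumFin {zero}  f = -0#≈0#
  -‿distrib-sumFin {suc m} f = trans (sym (-‿+-comm _ _)) (+-congˡ (-‿distrib-sumFin (f ∘ F.suc)))

  signPS-cong : ∀ k {p q} → p ≈ q → signPS k p ≈ signPS k q
  signPS-cong zero    p≈q = p≈q
  signPS-cong (suc k) p≈q = -‿cong (signPS-cong k p≈q)

  signPS-*ˡ : ∀ k q p → signPS k (q * p) ≈ q * signPS k p
  signPS-*ˡ zero    q p = refl
  signPS-*ˡ (suc k) q p = trans (-‿cong (signPS-*ˡ k q p)) (-‿distribʳ-* q _)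

  signPS-+ : ∀ k p q → signPS k (p + q) ≈ signPS k p + signPS k q
  signPS-+ zero    p q = refl
  signPS-+ (suc k) p q = trans (-‿cong (signPS-+ k p q)) (sym (-‿+-comm _ _))

  signPS-neg : ∀ k p → signPS k (- p) ≈ - signPS k p
  signPS-neg zero    p = refl
  signPS-neg (suc k) p = -‿cong (signPS-neg k p)

  signPS-zero : ∀ k {p} → p ≈ 0# → signPS k p ≈ 0#
  signPS-zero zero    p≈0 = p≈0
  signPS-zero (suc k) p≈0 = trans (-‿cong (signPS-zero k p≈0)) -0#≈0#

  det-cong : ∀ m {M M′ : Fin m → Fin m → Carrier} → (∀ a b → M a b ≈ M′ a b) → det m M ≈ det m M′
  det-cong zero    M≈M′ = refl
  det-cong (suc m) M≈M′ = sumFin-cong (λ j → signPS-cong (toℕ j)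
    (*-cong (M≈M′ F.zero j) (det-cong m (λ a b → M≈M′ (F.suc a) (punchIn j b)))))

  expansion-linear : ∀ {m} (u v : Carrier) (f g : Fin m → Carrier) →
                     sumFin (λ j → signPS (toℕ j) (u * f j + v * g j))
                     ≈ u * sumFin (λ j → signPS (toℕ j) (f j)) + v * sumFin (λ j → signPS (toℕ j) (g j))
  expansion-linear u v f g = begin
    sumFin (λ j → signPS (toℕ j) (u * f j + v * g j))
      ≈⟨ sumFin-cong (λ j → trans (signPS-+ (toℕ j) (u * f j) (v * g j))
                                  (+-cong (signPS-*ˡ (toℕ j) u (f j)) (signPS-*ˡ (toℕ j) v (g j)))) ⟩
    sumFin (λ j → u * signPS (toℕ j) (f j) + v * signPS (toℕ j) (g j))
      ≈⟨ sumFin-distrib-+ (λ j → u * signPS (toℕ j) (f j)) (λ j → v * signPS (toℕ j) (g j)) ⟩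
    sumFin (λ j → u * signPS (toℕ j) (f j)) + sumFin (λ j → v * signPS (toℕ j) (g j))
      ≈⟨ +-cong (*-distribˡ-sumFin u (λ j → signPS (toℕ j) (f j))) (*-distribˡ-sumFin v (λ j → signPS (toℕ j) (g j))) ⟨
    u * sumFin (λ j → signPS (toℕ j) (f j)) + v * sumFin (λ j → signPS (toℕ j) (g j)) ∎

  det-linear-row : ∀ m (p : Fin m) (M A B : Fin m → Fin m → Carrier) (u v : Carrier) →
                   (∀ a b → a ≢ p → A a b ≈ M a b) → (∀ a b → a ≢ p → B a b ≈ M a b) →
                   (∀ b → M p b ≈ u * A p b + v * B p b) →
                   det m M ≈ u * det m A + v * det m B
  det-linear-row (suc m) F.zero M A B u v A≈M B≈M Mp≈ = begin
    sumFin (λ j → signPS (toℕ j) (M F.zero j * det m (minor M j)))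
      ≈⟨ sumFin-cong (λ j → signPS-cong (toℕ j)
           (trans (*-congʳ (Mp≈ j)) (distribʳ (det m (minor M j)) (u * A F.zero j) (v * B F.zero j)))) ⟩
    sumFin (λ j → signPS (toℕ j) (u * A F.zero j * det m (minor M j) + v * B F.zero j * det m (minor M j)))
      ≈⟨ sumFin-cong (λ j → signPS-cong (toℕ j)
           (+-cong (trans (*-assoc u (A F.zero j) _) (*-congˡ (*-congˡ (sameMinor A A≈M j))))
                   (trans (*-assoc v (B F.zero j) _) (*-congˡ (*-congˡ (sameMinor B B≈M j)))))) ⟩
    sumFin (λ j → signPS (toℕ j) (u * (A F.zero j * det m (minor A j)) + v * (B F.zero j * det m (minor B j))))
      ≈⟨ expansion-linear u v (λ j → A F.zero j * det m (minor A j)) (λ j → B F.zero j * det m (minor B j)) ⟩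
    u * det (suc m) A + v * det (suc m) B ∎
    where
    sameMinor : ∀ N → (∀ a b → a ≢ F.zero → N a b ≈ M a b) → ∀ j → det m (minor M j) ≈ det m (minor N j)
    sameMinor N N≈M j = det-cong m (λ a b → sym (N≈M (F.suc a) (punchIn j b) λ ()))
  det-linear-row (suc m) (F.suc p) M A B u v A≈M B≈M Mp≈ = begin
    sumFin (λ j → signPS (toℕ j) (M F.zero j * det m (minor M j)))
      ≈⟨ sumFin-cong (λ j → signPS-cong (toℕ j) (*-congˡ {M F.zero j} (det-linear-row m p (minor M j) (minor A j) (minor B j) u v
            (λ a b a≢p → A≈M (F.suc a) (punchIn j b) (a≢p ∘ FP.suc-injective))
            (λ a b a≢p → B≈M (F.suc a) (punchIn j b) (a≢p ∘ FP.suc-injective))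
            (λ b → Mp≈ (punchIn j b))))) ⟩
    sumFin (λ j → signPS (toℕ j) (M F.zero j * (u * det m (minor A j) + v * det m (minor B j))))
      ≈⟨ sumFin-cong (λ j → signPS-cong (toℕ j) (trans (distribˡ (M F.zero j) (u * det m (minor A j)) (v * det m (minor B j)))
           (+-cong (trans (x∙yz≈y∙xz (M F.zero j) u _) (*-congˡ (*-congʳ (sym (A≈M F.zero j λ ())))))
                   (trans (x∙yz≈y∙xz (M F.zero j) v _) (*-congˡ (*-congʳ (sym (B≈M F.zero j λ ())))))))) ⟩
    sumFin (λ j → signPS (toℕ j) (u * (A F.zero j * det m (minor A j)) + v * (B F.zero j * det m (minor B j))))
      ≈⟨ expansion-linear u v (λ j → A F.zero j * det m (minor A j)) (λ j → B F.zero j * det m (minor B j)) ⟩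
    u * det (suc m) A + v * det (suc m) B ∎

  RespectsPointwise : ∀ {m n} → ((Fin m → Fin n) → Carrier) → Set ℓ
  RespectsPointwise Φ = ∀ g g′ → (∀ b → g b ≡ g′ b) → Φ g ≈ Φ g′

  -- The expansion of det along two rows u and v; Φ g is the minor of the other rows on the columns g.
  doubleExpansion : ∀ m → (u v : Fin (suc (suc m)) → Carrier) → ((Fin m → Fin (suc (suc m))) → Carrier) → Carrier
  doubleExpansion m u v Φ =
    sumFin (λ j → signPS (toℕ j) (u j * sumFin (λ l → signPS (toℕ l) (v (punchIn j l) * Φ (punchIn j ∘ punchIn l)))))

  doubleExpansion-≈0 : ∀ m (u v : Fin (suc (suc m)) → Carrier) (Φ : (Fin m → Fin (suc (suc m))) → Carrier) →
                       (∀ j → u j ≈ v j) → RespectsPointwise Φ → doubleExpansion m u v Φ ≈ 0#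

  doubleExpansion-tail-≈0 : ∀ m (u v : Fin (suc (suc m)) → Carrier) (Φ : (Fin m → Fin (suc (suc m))) → Carrier) →
    (∀ j → u j ≈ v j) → RespectsPointwise Φ →
    sumFin (λ j → signPS (toℕ j) (u (F.suc j) *
      sumFin (λ l → signPS (toℕ l) (v (F.suc (punchIn j l)) * Φ (punchIn (F.suc j) ∘ punchIn (F.suc l)))))) ≈ 0#
  doubleExpansion-tail-≈0 zero    u v Φ u≈v Φ-resp =
    sumFin-zero {1} (λ j → signPS-zero (toℕ j) (zeroʳ (u (F.suc j))))
  doubleExpansion-tail-≈0 (suc m) u v Φ u≈v Φ-resp = trans
    (sumFin-cong {suc (suc m)} (λ j → signPS-cong (toℕ j) (*-congˡ {u (F.suc j)} (sumFin-cong {suc m} (λ l →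
      signPS-cong (toℕ l) (*-congˡ {v (F.suc (punchIn j l))} (Φ-resp (punchIn (F.suc j) ∘ punchIn (F.suc l)) (F.lift 1 (punchIn j ∘ punchIn l))
        λ { F.zero → P.refl ; (F.suc b) → P.refl })))))))
    (doubleExpansion-≈0 m (u ∘ F.suc) (v ∘ F.suc) (Φ ∘ F.lift 1) (u≈v ∘ F.suc)
      (λ g g′ g≗g′ → Φ-resp (F.lift 1 g) (F.lift 1 g′) λ { F.zero → P.refl ; (F.suc b) → P.cong F.suc (g≗g′ b) }))

  -- The terms with j = 0 cancel those with l = 0 because u = v; the rest is an expansion of size m − 1.
  doubleExpansion-≈0 m u v Φ u≈v Φ-resp = begin
    first + sumFin rest
      ≈⟨ +-congˡ (sumFin-cong (λ j → peel (toℕ j) (u (F.suc j)) (v F.zero * A j) (inner j) _ (sym (-‿distrib-sumFin (term j))))) ⟩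
    first + sumFin (λ j → - paired j + signPS (toℕ j) (u (F.suc j) * inner j))
      ≈⟨ +-congˡ (sumFin-distrib-+ (λ j → - paired j) (λ j → signPS (toℕ j) (u (F.suc j) * inner j))) ⟩
    first + (sumFin (λ j → - paired j) + sumFin (λ j → signPS (toℕ j) (u (F.suc j) * inner j)))
      ≈⟨ +-congˡ (+-congˡ (doubleExpansion-tail-≈0 m u v Φ u≈v Φ-resp)) ⟩
    first + (sumFin (λ j → - paired j) + 0#)
      ≈⟨ +-congˡ (trans (+-identityʳ _) (sym (-‿distrib-sumFin paired))) ⟩
    first + - sumFin paired
      ≈⟨ +-congʳ first≈paired ⟩
    sumFin paired + - sumFin paired
      ≈⟨ -‿inverseʳ _ ⟩
    0# ∎
    where
    A : Fin (suc m) → Carrier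
    A l = Φ (F.suc ∘ punchIn l)
    term : Fin (suc m) → Fin m → Carrier
    term j l = signPS (toℕ l) (v (F.suc (punchIn j l)) * Φ (punchIn (F.suc j) ∘ punchIn (F.suc l)))
    inner : Fin (suc m) → Carrier
    inner j = sumFin (term j)
    first : Carrier
    first = u F.zero * sumFin (λ l → signPS (toℕ l) (v (F.suc l) * A l))
    rest : Fin (suc m) → Carrier
    rest j = - signPS (toℕ j) (u (F.suc j) * (v F.zero * A j + sumFin (λ l → - term j l)))
    paired : Fin (suc m) → Carrier
    paired j = signPS (toℕ j) (u (F.suc j) * (v F.zero * A j))
    peel : ∀ k (a w I I′ : Carrier) → I′ ≈ - I → - signPS k (a * (w + I′)) ≈ - signPS k (a * w) + signPS k (a * I)
    peel k a w I I′ I′≈-I = begin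
      - signPS k (a * (w + I′))
        ≈⟨ -‿cong (signPS-cong k (trans (distribˡ a w I′) (+-congˡ (trans (*-congˡ I′≈-I) (sym (-‿distribʳ-* a I)))))) ⟩
      - signPS k (a * w + - (a * I))             ≈⟨ -‿cong (trans (signPS-+ k _ _) (+-congˡ (signPS-neg k _))) ⟩
      - (signPS k (a * w) + - signPS k (a * I))  ≈⟨ -‿+-comm _ _ ⟨
      - signPS k (a * w) + - - signPS k (a * I)  ≈⟨ +-congˡ (-‿involutive _) ⟩
      - signPS k (a * w) + signPS k (a * I)      ∎
    first≈paired : first ≈ sumFin paired
    first≈paired = trans (*-distribˡ-sumFin (u F.zero) (λ l → signPS (toℕ l) (v (F.suc l) * A l)))
      (sumFin-cong (λ l → trans (sym (signPS-*ˡ (toℕ l) (u F.zero) (v (F.suc l) * A l))) (signPS-cong (toℕ l)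
        (trans (*-cong (u≈v F.zero) (*-congʳ (sym (u≈v (F.suc l))))) (x∙yz≈y∙xz (v F.zero) (u (F.suc l)) (A l))))))

  det-equal-first-rows : ∀ m (M : Fin (suc (suc m)) → Fin (suc (suc m)) → Carrier) →
                         (∀ b → M F.zero b ≈ M (F.suc F.zero) b) → det (suc (suc m)) M ≈ 0#
  det-equal-first-rows m M rows≈ = doubleExpansion-≈0 m (M F.zero) (M (F.suc F.zero))
    (λ g → det m (λ a b → M (F.suc (F.suc a)) (g b))) rows≈
    (λ g g′ g≗g′ → det-cong m (λ a b → reflexive (P.cong (M (F.suc (F.suc a))) (g≗g′ b))))

  det-equal-adjacent-rows : ∀ m (p : Fin (suc m)) (M : Fin (suc (suc m)) → Fin (suc (suc m)) → Carrier) →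
                            (∀ b → M (inject₁ p) b ≈ M (F.suc p) b) → det (suc (suc m)) M ≈ 0#
  det-equal-adjacent-rows m       F.zero    M rows≈ = det-equal-first-rows m M rows≈
  det-equal-adjacent-rows (suc m) (F.suc p) M rows≈ = sumFin-zero {suc (suc (suc m))} (λ j → signPS-zero (toℕ j)
    (trans (*-congˡ {M F.zero j} (det-equal-adjacent-rows m p (minor M j) (λ b → rows≈ (punchIn j b)))) (zeroʳ (M F.zero j))))

  toℕ-punchIn-≥ : ∀ {m} (j : Fin (suc m)) (b : Fin m) → toℕ j ≤ toℕ b → toℕ (punchIn j b) ≡ suc (toℕ b)
  toℕ-punchIn-≥ F.zero    b         _         = P.refl
  toℕ-punchIn-≥ (F.suc j) (F.suc b) (s≤s j≤b) = P.cong suc (toℕ-punchIn-≥ j b j≤b)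

  det-zero-block : ∀ q m (M : Fin m → Fin m → Carrier) → q < m →
                   (∀ a b → toℕ a ≤ q → q ≤ toℕ b → M a b ≈ 0#) → det m M ≈ 0#
  det-zero-block zero    (suc m) M _         M≈0 = sumFin-zero {suc m} (λ j → signPS-zero (toℕ j)
    (trans (*-congʳ (M≈0 F.zero j z≤n z≤n)) (zeroˡ (det m (minor M j)))))
  det-zero-block (suc q) (suc m) M (s≤s q<m) M≈0 = sumFin-zero {suc m} (λ j → signPS-zero (toℕ j) (term j))
    where
    term : ∀ j → M F.zero j * det m (minor M j) ≈ 0#
    term j with toℕ j ≤? q
    ... | yes j≤q = trans (*-congˡ {M F.zero j} (det-zero-block q m (minor M j) q<m (λ a b a≤q q≤b →
                      M≈0 (F.suc a) (punchIn j b) (s≤s a≤q)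
                        (P.subst (suc q ≤_) (P.sym (toℕ-punchIn-≥ j b (NP.≤-trans j≤q q≤b))) (s≤s q≤b)))))
                      (zeroʳ (M F.zero j))
    ... | no j≰q  = trans (*-congʳ (M≈0 F.zero j z≤n (NP.≰⇒> j≰q))) (zeroˡ (det m (minor M j)))

  matrix : ∀ m → (ℕ → ℕ → Carrier) → Fin m → Fin m → Carrier
  matrix m E a b = E (toℕ a) (toℕ b)

  det-row-combination : ∀ m (E E′ : ℕ → ℕ → Carrier) t (u v : Carrier) → suc t < m →
    (∀ i j → i < m → j < m → i ≢ t → E′ i j ≈ E i j) → (∀ j → j < m → E′ t j ≈ u * E t j + v * E (suc t) j) →
    det m (matrix m E′) ≈ u * det m (matrix m E)
  -- Linearity in row t; the v-part has row t replaced by row t + 1, so it has two equal rows.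
  det-row-combination (suc (suc m)) E E′ t u v (s≤s 1+t<1+m) E′≈E E′t≈ = begin
    det (suc (suc m)) (matrix _ E′)
      ≈⟨ det-linear-row (suc (suc m)) (inject₁ p) (matrix _ E′) (matrix _ E) (matrix _ E₊) u v
           (λ a b a≢p → sym (E′≈E (toℕ a) (toℕ b) (FP.toℕ<n a) (FP.toℕ<n b) (toℕ-≢ a≢p)))
           (λ a b a≢p → trans (reflexive (if-false (≢⇒¬≡ᵇ (toℕ-≢ a≢p))))
                              (sym (E′≈E (toℕ a) (toℕ b) (FP.toℕ<n a) (FP.toℕ<n b) (toℕ-≢ a≢p))))
           (λ b → P.subst (λ i → E′ i (toℕ b) ≈ u * E i (toℕ b) + v * E₊ i (toℕ b)) (P.sym toℕp≡t)
                    (trans (E′t≈ (toℕ b) (FP.toℕ<n b)) (+-congˡ (*-congˡ (sym (reflexive (if-true (≡ᵇ-refl t)))))))) ⟩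
    u * det (suc (suc m)) (matrix _ E) + v * det (suc (suc m)) (matrix _ E₊)
      ≈⟨ +-congˡ (trans (*-congˡ (det-equal-adjacent-rows m p (matrix _ E₊) E₊-adjacent)) (zeroʳ v)) ⟩
    u * det (suc (suc m)) (matrix _ E) + 0#
      ≈⟨ +-identityʳ _ ⟩
    u * det (suc (suc m)) (matrix _ E) ∎
    where
    p : Fin (suc m)
    p = F.fromℕ< 1+t<1+m
    toℕp≡t : toℕ (inject₁ p) ≡ t
    toℕp≡t = P.trans (FP.toℕ-inject₁ p) (FP.toℕ-fromℕ< 1+t<1+m)
    toℕ-≢ : ∀ {a} → a ≢ inject₁ p → toℕ a ≢ t
    toℕ-≢ a≢p toℕa≡t = a≢p (FP.toℕ-injective (P.trans toℕa≡t (P.sym toℕp≡t)))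
    E₊ : ℕ → ℕ → Carrier
    E₊ i j = if i ≡ᵇ t then E (suc t) j else E i j
    E₊-adjacent : ∀ b → matrix _ E₊ (inject₁ p) b ≈ matrix _ E₊ (F.suc p) b
    E₊-adjacent b rewrite toℕp≡t | FP.toℕ-fromℕ< 1+t<1+m =
      reflexive (P.trans (if-true (≡ᵇ-refl t)) (P.sym (if-false (≢⇒¬≡ᵇ (NP.1+n≢n {t})))))

  det-≈0-by-row-reduction : ∀ m (E : ℕ → ℕ → Carrier) (V : ℕ → Carrier) q → suc q < m →
    (∀ i j → i ≤ q → q ≤ j → j < m → E i j + V i * E (suc i) j ≈ 0#) → det m (matrix m E) ≈ 0#
  -- Adding V i times row i + 1 to row i, for i = 0, …, q, keeps det and makes rows 0, …, q vanish on the columns ≥ q.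
  det-≈0-by-row-reduction m E V q 1+q<m reduced≈0 = trans (sym (reduce (suc q) NP.≤-refl))
    (det-zero-block q m (matrix m (reducedTo (suc q))) (NP.<-trans (NP.n<1+n q) 1+q<m)
       (λ a b a≤q q≤b → trans (reflexive (if-true (NP.<⇒<ᵇ (s≤s a≤q)))) (reduced≈0 (toℕ a) (toℕ b) a≤q q≤b (FP.toℕ<n b))))
    where
    reducedTo : ℕ → ℕ → ℕ → Carrier
    reducedTo t i j = if i <ᵇ t then E i j + V i * E (suc i) j else E i j
    untouched : ∀ {t i} j → ¬ i < t → reducedTo t i j ≈ E i j
    untouched {t} {i} j i≮t = reflexive (if-false λ i<ᵇt → i≮t (NP.<ᵇ⇒< i t i<ᵇt))
    reduce : ∀ t → t ≤ suc q → det m (matrix m (reducedTo t)) ≈ det m (matrix m E)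
    reduce zero    _       = refl
    reduce (suc t) 1+t≤1+q = trans
      (trans (det-row-combination m (reducedTo t) (reducedTo (suc t)) t 1# (V t) (NP.≤-<-trans 1+t≤1+q 1+q<m)
        (λ i j _ _ i≢t → sameRow i j i≢t)
        (λ j _ → trans (reflexive (if-true (NP.<⇒<ᵇ (NP.n<1+n t))))
          (+-cong (trans (sym (*-identityˡ _)) (*-congˡ (sym (untouched j (NP.n≮n t)))))
                  (*-congˡ (sym (untouched j (NP.n≮n t ∘ NP.<-trans (NP.n<1+n t))))))))
       (*-identityˡ _))
      (reduce t (NP.≤-trans (NP.n≤1+n t) 1+t≤1+q))
      where
      sameRow : ∀ i j → i ≢ t → reducedTo (suc t) i j ≈ reducedTo t i j
      sameRow i j i≢t with i <? t
      ... | yes i<t = reflexive (P.trans (if-true (NP.<⇒<ᵇ (NP.m<n⇒m<1+n i<t))) (P.sym (if-true (NP.<⇒<ᵇ i<t))))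
      ... | no i≮t  = trans (untouched j (λ i<1+t → i≮t (NP.≤∧≢⇒< (NP.≤-pred i<1+t) i≢t))) (sym (untouched j i≮t))

module SeriesDeterminant {c ℓ} (R : CommutativeRing c ℓ) where

  open WithRing R
  open PowerSeries R
  module Det = Determinant PSR

  sumFin≋ : ∀ {m} (f : Fin m → PS) → sumFin f ≋ Det.sumFin f
  sumFin≋ {zero}  f = PS.refl
  sumFin≋ {suc m} f = PS.+-cong (PS.refl {f F.zero}) (sumFin≋ (f ∘ F.suc))

  signPS≋ : ∀ k p → signPS k p ≋ Det.signPS k p
  signPS≋ zero    p = PS.refl
  signPS≋ (suc k) p = PS.-‿cong (signPS≋ k p)

  det≋ : ∀ m M → det m M ≋ Det.det m M
  det≋ zero    M = PS.refl
  det≋ (suc m) M = PS.trans (sumFin≋ term) (Det.sumFin-cong (λ j →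
    PS.trans (signPS≋ (toℕ j) _) (Det.signPS-cong (toℕ j) (mulPS-congˡ (M F.zero j) (det≋ m (Det.minor M j))))))
    where
    term : Fin (suc m) → PS
    term j = signPS (toℕ j) (mulPS (M F.zero j) (det m (Det.minor M j)))

module CompleteHomogeneous {c ℓ} (R : CommutativeRing c ℓ) where

  open CommutativeRing R using (Carrier)
  open WithRing R
  open PowerSeries R
  open PowerSeriesProducts R
  open SetoidReasoning PS.setoid

  indZ-≤ : ∀ {l a} → l ≤ a → indZ (l ≤ᵇ a) ≡ + 1
  indZ-≤ l≤a = if-true (NP.≤⇒≤ᵇ l≤a)

  indZ-> : ∀ {l a} → a < l → indZ (l ≤ᵇ a) ≡ + 0
  indZ-> a<l = if-false (>⇒¬≤ᵇ a<l)

  -- hComb v e N = h[e₁ v₁ + ⋯ + e_N v_N] and hDiff v a b = h[V_a − V_b], where V_m = v₁ + ⋯ + v_m.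
  hComb : (ℕ → Carrier) → (ℕ → ℤ) → ℕ → PS
  hComb v e N = prodPS (map (λ l → Pfac (v l) (e l)) (rangeL 1 N))

  hComb-snoc : ∀ v e N → hComb v e (suc N) ≋ mulPS (hComb v e N) (Pfac (v (suc N)) (e (suc N)))
  hComb-snoc v e N = prodPS-rangeL-snoc (λ l → Pfac (v l) (e l)) (s≤s z≤n)

  hComb-cong : ∀ v {e e′} N → (∀ l → e l ≡ e′ l) → hComb v e N ≋ hComb v e′ N
  hComb-cong v N e≗e′ = prodPS-map-cong (rangeL 1 N) (λ l _ → ≡⇒≋ (P.cong (Pfac (v l)) (e≗e′ l)))

  hComb-+ : ∀ v e e′ N → hComb v (λ l → e l Z.+ e′ l) N ≋ mulPS (hComb v e N) (hComb v e′ N)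
  hComb-+ v e e′ N = PS.trans (prodPS-map-cong (rangeL 1 N) (λ l _ → Pfac-+ (v l) (e l) (e′ l)))
                              (prodPS-map-* (rangeL 1 N) (λ l → Pfac (v l) (e l)) (λ l → Pfac (v l) (e′ l)))

  hComb-zero : ∀ v e N → (∀ l → l ≤ N → e l ≡ + 0) → hComb v e N ≋ onePS
  hComb-zero v e zero    e≡0 = PS.refl
  hComb-zero v e (suc N) e≡0 = begin
    hComb v e (suc N)                                  ≈⟨ hComb-snoc v e N ⟩
    mulPS (hComb v e N) (Pfac (v (suc N)) (e (suc N))) ≈⟨ PS.*-cong (hComb-zero v e N (λ l l≤N → e≡0 l (NP.m≤n⇒m≤1+n l≤N)))
                                                                     (≡⇒≋ (P.cong (Pfac (v (suc N))) (e≡0 (suc N) NP.≤-refl))) ⟩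
    mulPS onePS onePS                                  ≈⟨ PS.*-identityˡ onePS ⟩
    onePS                                              ∎

  hComb-extend : ∀ v e {N N′} → N ≤ N′ → (∀ l → N < l → e l ≡ + 0) → hComb v e N ≋ hComb v e N′
  hComb-extend v e {N} {N′} N≤N′ e≡0 = P.subst (λ M → hComb v e N ≋ hComb v e M) (NP.m+[n∸m]≡n N≤N′) (go (N′ ∸ N))
    where
    go : ∀ d → hComb v e N ≋ hComb v e (N N.+ d)
    go zero rewrite NP.+-identityʳ N = PS.refl
    go (suc d) rewrite NP.+-suc N d = PS.sym (begin
      hComb v e (suc (N N.+ d))                                        ≈⟨ hComb-snoc v e (N N.+ d) ⟩
      mulPS (hComb v e (N N.+ d)) (Pfac (v (suc (N N.+ d))) (e (suc (N N.+ d))))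
        ≈⟨ mulPS-congˡ (hComb v e (N N.+ d)) (≡⇒≋ (P.cong (Pfac (v (suc (N N.+ d)))) (e≡0 (suc (N N.+ d)) (s≤s (NP.m≤m+n N d))))) ⟩
      mulPS (hComb v e (N N.+ d)) onePS                                ≈⟨ mulPS-identityʳ _ ⟩
      hComb v e (N N.+ d)                                              ≈⟨ go d ⟨
      hComb v e N                                                      ∎)

  diff : ℕ → ℕ → ℕ → ℤ
  diff a b l = indZ (l ≤ᵇ a) Z.- indZ (l ≤ᵇ b)

  hDiff : (ℕ → Carrier) → ℕ → ℕ → PS
  hDiff v a b = hComb v (diff a b) (a N.+ b)

  diff-beyond : ∀ {a b l} → a < l → b < l → diff a b l ≡ + 0
  diff-beyond a<l b<l rewrite indZ-> a<l | indZ-> b<l = P.refl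

  hDiff-extend : ∀ v a b {N} → a N.+ b ≤ N → hDiff v a b ≋ hComb v (diff a b) N
  hDiff-extend v a b a+b≤N = hComb-extend v (diff a b) a+b≤N
    (λ l a+b<l → diff-beyond (NP.≤-<-trans (NP.m≤m+n a b) a+b<l) (NP.≤-<-trans (NP.m≤n+m b a) a+b<l))

  hDiff-trans : ∀ v a b c′ → hDiff v a c′ ≋ mulPS (hDiff v a b) (hDiff v b c′)
  hDiff-trans v a b c′ = begin
    hDiff v a c′                                             ≈⟨ hDiff-extend v a c′ (NP.+-monoˡ-≤ c′ (NP.m≤m+n a b)) ⟩
    hComb v (diff a c′) N                                    ≈⟨ hComb-cong v N (λ l → telescope (indZ (l ≤ᵇ a)) (indZ (l ≤ᵇ b)) (indZ (l ≤ᵇ c′))) ⟩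
    hComb v (λ l → diff a b l Z.+ diff b c′ l) N             ≈⟨ hComb-+ v (diff a b) (diff b c′) N ⟩
    mulPS (hComb v (diff a b) N) (hComb v (diff b c′) N)     ≈⟨ PS.*-cong (hDiff-extend v a b (NP.m≤m+n (a N.+ b) c′))
                                                                          (hDiff-extend v b c′ (NP.+-monoˡ-≤ c′ (NP.m≤n+m b a))) ⟨
    mulPS (hDiff v a b) (hDiff v b c′)                       ∎
    where
    N : ℕ
    N = a N.+ b N.+ c′
    telescope : ∀ p q r → p Z.- r ≡ (p Z.- q) Z.+ (q Z.- r)
    telescope = ZSolver.solve-∀

  hDiff-self : ∀ v a → hDiff v a a ≋ onePS
  hDiff-self v a = hComb-zero v (diff a a) (a N.+ a) (λ l _ → ZP.+-inverseʳ (indZ (l ≤ᵇ a)))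

  hDiff-suc : ∀ v b → hDiff v (suc b) b ≋ geom (v (suc b))
  hDiff-suc v b = begin
    hDiff v (suc b) b                                                ≈⟨ hComb-extend v (diff (suc b) b) (NP.m≤m+n (suc b) b) beyond ⟨
    hComb v (diff (suc b) b) (suc b)                                 ≈⟨ hComb-snoc v (diff (suc b) b) b ⟩
    mulPS (hComb v (diff (suc b) b) b) (Pfac (v (suc b)) (diff (suc b) b (suc b)))
      ≈⟨ PS.*-cong (hComb-zero v (diff (suc b) b) b (λ l l≤b → P.trans (P.cong₂ Z._-_ (indZ-≤ (NP.m≤n⇒m≤1+n l≤b)) (indZ-≤ l≤b)) P.refl))
                   (≡⇒≋ (P.cong (Pfac (v (suc b))) (P.cong₂ Z._-_ (indZ-≤ (NP.≤-refl {suc b})) (indZ-> (NP.n<1+n b))))) ⟩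
    mulPS onePS (mulPS (geom (v (suc b))) onePS)                     ≈⟨ PS.trans (PS.*-identityˡ _) (mulPS-identityʳ _) ⟩
    geom (v (suc b))                                                 ∎
    where
    beyond : ∀ l → suc b < l → diff (suc b) b l ≡ + 0
    beyond l 1+b<l = diff-beyond 1+b<l (NP.<-trans (NP.n<1+n b) 1+b<l)

module RowRecurrence {c ℓ} (R : CommutativeRing c ℓ) where

  open CommutativeRing R
  open WithRing R
  open PowerSeries R
  open SetoidReasoning setoid

  open RingProperties ring using (-0#≈0#; xyx⁻¹≈y; //-rightDividesʳ)
  open CommutativeSemigroupProperties +-commutativeSemigroup using () renaming (x∙yz≈y∙xz to +-exchange)
  open Solver commutativeSemiring using (solve; _:=_; _:+_; _:*_)

  +-cancel-pair : ∀ a b c′ → ((a + (b + c′)) + - b) + - c′ ≈ a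
  +-cancel-pair a b c′ = trans (+-congʳ (trans (+-congʳ (+-exchange a b c′)) (xyx⁻¹≈y b (a + c′)))) (//-rightDividesʳ c′ a)

  row-recurrence : ∀ (X X′ Z W : PS) (y b : Carrier) C →
    X 0 ≈ X′ 0 → (∀ d → X (suc d) ≈ X′ (suc d) + y * X d) → (∀ e → Z (suc e) ≈ W (suc e) + b * Z e) →
    (λ d → X′ d * Z (C N.+ d)) ≋
      addPS (mulPS (oneMinus (b * y)) (λ d → X d * Z (C N.+ d))) (mulPS (negPS (monomial y 1)) (λ d → X d * W (suc C N.+ d)))
  row-recurrence X X′ Z W y b C X₀ X-rec Z-rec = coefficient
    where
    E E₊ : PS
    E  d = X d * Z (C N.+ d)
    E₊ d = X d * W (suc C N.+ d)
    shifted : ∀ d → mulPS (negPS (monomial y 1)) E₊ d ≈ - mulPS (monomial y 1) E₊ d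
    shifted d = sym (negPS-distribˡ-mulPS (monomial y 1) E₊ d)
    coefficient : ∀ d → X′ d * Z (C N.+ d) ≈ mulPS (oneMinus (b * y)) E d + mulPS (negPS (monomial y 1)) E₊ d
    coefficient zero = sym (begin
      mulPS (oneMinus (b * y)) E 0 + mulPS (negPS (monomial y 1)) E₊ 0
        ≈⟨ +-cong (oneMinus-*-zero (b * y) E) (trans (shifted 0) (-‿cong (monomial-*-< y 1 E₊ (s≤s z≤n)))) ⟩
      E 0 + - 0#                 ≈⟨ +-congˡ (-0#≈0#) ⟩
      E 0 + 0#                   ≈⟨ +-identityʳ _ ⟩
      X 0 * Z (C N.+ 0)          ≈⟨ *-congʳ X₀ ⟩
      X′ 0 * Z (C N.+ 0)         ∎)
    coefficient (suc d) rewrite NP.+-suc C d = sym (begin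
      mulPS (oneMinus (b * y)) E (suc d) + mulPS (negPS (monomial y 1)) E₊ (suc d)
        ≈⟨ +-cong (oneMinus-*-suc (b * y) E d) (trans (shifted (suc d)) (-‿cong (monomial-*-≥ y 1 E₊ (s≤s z≤n)))) ⟩
      (E (suc d) + - (b * y * E d)) + - (y * E₊ d)
        ≈⟨ +-congʳ (+-congʳ (reflexive (P.cong (λ e → X (suc d) * Z e) (NP.+-suc C d)))) ⟩
      (X (suc d) * Z (suc (C N.+ d)) + - (b * y * E d)) + - (y * E₊ d)
        ≈⟨ +-congʳ (+-congʳ (trans (*-congʳ (X-rec d))
             (trans (distribʳ _ _ _) (+-congˡ (trans (*-assoc _ _ _) (*-congˡ (*-congˡ (Z-rec (C N.+ d))))))))) ⟩
      ((X′ (suc d) * Z (suc (C N.+ d)) + y * (X d * (W (suc (C N.+ d)) + b * Z (C N.+ d)))) + - (b * y * E d)) + - (y * E₊ d)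
        ≈⟨ +-congʳ (+-congʳ (+-congˡ (solve 5 (λ y q w b z → y :* (q :* (w :+ b :* z)) := b :* y :* (q :* z) :+ y :* (q :* w))
                                            refl y (X d) (W (suc (C N.+ d))) b (Z (C N.+ d))))) ⟩
      ((X′ (suc d) * Z (suc (C N.+ d)) + (b * y * E d + y * E₊ d)) + - (b * y * E d)) + - (y * E₊ d)
        ≈⟨ +-cancel-pair _ _ _ ⟩
      X′ (suc d) * Z (suc (C N.+ d)) ∎)

module Entries {c ℓ} (R : CommutativeRing c ℓ) (n : ℕ) (la mu r s : ℕ → ℕ) (x α β : ℕ → CommutativeRing.Carrier R) where

  open CommutativeRing R
  open WithRing R
  open PowerSeries R
  open PowerSeriesProducts R using (prodPS-++; prodPS-rangeL-snoc)
  open CompleteHomogeneous R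
  open PSSolver using (solve; _:=_; _:*_)

  X : ℕ → ℕ → PS
  X = hX n la mu r s x α β

  Z : ℕ → ℕ → PS
  Z = hZ n la mu r s x α β

  entryWith : (ℕ → ℕ) → ℕ → ℕ → PS
  entryWith s′ = entry n la mu r s′ x α β

  X-const-term : ∀ a b → X a b 0 ≈ 1#
  X-const-term a b = prodPS-map-const-term (rangeL a b) (λ l → Pfac (x l) (+ 1))
                       (λ l → trans (+-identityˡ _) (*-identityˡ 1#))

  X-snoc : ∀ {a b} → a ≤ suc b → X a (suc b) ≋ mulPS (X a b) (geom (x (suc b)))
  X-snoc {a} {b} a≤1+b = PS.trans (prodPS-rangeL-snoc (λ l → Pfac (x l) (+ 1)) a≤1+b)
                                  (mulPS-congˡ (X a b) (mulPS-identityʳ (geom (x (suc b)))))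

  X-empty : ∀ {a b} → b < a → X a b ≋ onePS
  X-empty b<a = ≡⇒≋ (P.cong (λ L → prodPS (map (λ l → Pfac (x l) (+ 1)) L)) (rangeL-nil b<a))

  X-single : X 1 1 ≋ geom (x 1)
  X-single = PS.trans (mulPS-identityʳ _) (mulPS-identityʳ (geom (x 1)))

  Z-factor : ∀ i j → Z i j ≋ mulPS (hDiff α (la i) (mu j)) (hDiff β j (i ∸ 1))
  Z-factor i j = PS.trans (prodPS-++ αs βs) (mulPS-congˡ (hDiff α (la i) (mu j)) (PS.sym (hDiff-extend β j (i ∸ 1)
    (P.subst (j N.+ (i ∸ 1) ≤_) (NP.+-comm j i) (NP.+-monoʳ-≤ j (NP.m∸n≤m i 1))))))
    where
    αs βs : List PS
    αs = map (λ l → Pfac (α l) (diff (la i) (mu j) l)) (rangeL 1 (la i N.+ mu j))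
    βs = map (λ l → Pfac (β l) (diff j (i ∸ 1) l)) (rangeL 1 (i N.+ j))

  Q : ℕ → PS
  Q i = mulPS (hDiff α (la i) (la (suc i))) (hDiff β i (i ∸ 1))

  Z-step : ∀ i j → Z i j ≋ mulPS (Q i) (Z (suc i) j)
  Z-step i j = begin
    Z i j
      ≈⟨ Z-factor i j ⟩
    mulPS (hDiff α (la i) (mu j)) (hDiff β j (i ∸ 1))
      ≈⟨ PS.*-cong (hDiff-trans α (la i) (la (suc i)) (mu j)) (hDiff-trans β j i (i ∸ 1)) ⟩
    mulPS (mulPS a₁ a₂) (mulPS b₁ b₂)
      ≈⟨ solve 4 (λ a₁ a₂ b₁ b₂ → (a₁ :* a₂) :* (b₁ :* b₂) := (a₁ :* b₂) :* (a₂ :* b₁)) PS.refl a₁ a₂ b₁ b₂ ⟩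
    mulPS (Q i) (mulPS a₂ b₁)
      ≈⟨ mulPS-congˡ (Q i) (Z-factor (suc i) j) ⟨
    mulPS (Q i) (Z (suc i) j) ∎
    where
    open SetoidReasoning PS.setoid
    a₁ a₂ b₁ b₂ : PS
    a₁ = hDiff α (la i) (la (suc i))
    a₂ = hDiff α (la (suc i)) (mu j)
    b₁ = hDiff β j i
    b₂ = hDiff β i (i ∸ 1)

  Q-geom : ∀ t → la (suc (suc t)) ≡ la (suc t) → Q (suc t) ≋ geom (β (suc t))
  Q-geom t la-eq rewrite la-eq =
    PS.trans (PS.*-cong (hDiff-self α (la (suc t))) (hDiff-suc β t)) (PS.*-identityˡ (geom (β (suc t))))

  entry-shift : ∀ s′ i j d → entryWith s′ i j d ≈ X (r j) (s′ i) d * mulPS (monomial 1# (la i N.+ j)) (Z i j) (mu j N.+ i N.+ d)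
  entry-shift s′ i j d rewrite P.trans (NP.+-assoc d (mu j) i) (NP.+-comm d (mu j N.+ i)) with la i N.+ j ≤? mu j N.+ i N.+ d
  ... | yes A≤C+d = trans (reflexive (if-true (NP.≤⇒≤ᵇ A≤C+d)))
                          (*-congˡ (sym (trans (monomial-*-≥ 1# _ (Z i j) A≤C+d) (*-identityˡ _))))
  ... | no A≰C+d  = trans (reflexive (if-false (>⇒¬≤ᵇ (NP.≰⇒> A≰C+d))))
                          (sym (trans (*-congˡ (monomial-*-< 1# _ (Z i j) (NP.≰⇒> A≰C+d))) (zeroʳ _)))

  entry-cong-s : ∀ s₁ s₂ i j → s₁ i ≡ s₂ i → entryWith s₁ i j ≋ entryWith s₂ i j
  entry-cong-s s₁ s₂ i j s₁i≡s₂i d = trans (entry-shift s₁ i j d)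
    (trans (*-congʳ (reflexive (P.cong (λ b → X (r j) b d) s₁i≡s₂i))) (sym (entry-shift s₂ i j d)))

  entry-vanishes : ∀ s′ i j → X (r j) (s′ i) ≋ onePS → mu j N.+ i < la i N.+ j → entryWith s′ i j ≋ zeroPS
  entry-vanishes s′ i j X≋1 C<A zero = trans (entry-shift s′ i j 0)
    (trans (*-congˡ (monomial-*-< 1# _ (Z i j) (P.subst (_< la i N.+ j) (P.sym (NP.+-identityʳ _)) C<A))) (zeroʳ _))
  entry-vanishes s′ i j X≋1 C<A (suc d) = trans (entry-shift s′ i j (suc d)) (trans (*-congʳ (X≋1 (suc d))) (zeroˡ _))

  module RowRelation (t j : ℕ) (s′ : ℕ → ℕ) (1≤sk : 1 ≤ s (suc t)) (la-eq : la (suc (suc t)) ≡ la (suc t))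
                     (s-eq : s (suc (suc t)) ≡ s (suc t)) (s′k : s′ (suc t) ≡ s (suc t) ∸ 1)
                     (far : s (suc t) < r j → suc (mu j N.+ suc t) < la (suc t) N.+ j) where

    k : ℕ
    k = suc t

    u v : PS
    u = oneMinus (β k * x (s k))
    v = negPS (monomial (x (s k)) 1)

    combination : PS
    combination = addPS (mulPS u (entryWith s k j)) (mulPS v (entryWith s (suc k) j))

    relation-far : s k < r j → entryWith s′ k j ≋ combination
    relation-far sk<rj = PS.trans (entry-vanishes s′ k j X′-empty (NP.<-trans (NP.n<1+n _) (far sk<rj))) (PS.sym (begin
      combination                                ≈⟨ PS.+-cong (mulPS-congˡ u (entry-vanishes s k j X-empty′ (NP.<-trans (NP.n<1+n _) (far sk<rj))))
                                                              (mulPS-congˡ v (entry-vanishes s (suc k) j X₊-empty below)) ⟩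
      addPS (mulPS u zeroPS) (mulPS v zeroPS)    ≈⟨ PS.+-cong (PS.zeroʳ u) (PS.zeroʳ v) ⟩
      addPS zeroPS zeroPS                        ≈⟨ PS.+-identityˡ zeroPS ⟩
      zeroPS                                     ∎))
      where
      open SetoidReasoning PS.setoid
      X-empty′ : X (r j) (s k) ≋ onePS
      X-empty′ = X-empty sk<rj
      X′-empty : X (r j) (s′ k) ≋ onePS
      X′-empty rewrite s′k = X-empty (NP.≤-<-trans (NP.m∸n≤m (s k) 1) sk<rj)
      X₊-empty : X (r j) (s (suc k)) ≋ onePS
      X₊-empty rewrite s-eq = X-empty sk<rj
      below : mu j N.+ suc k < la (suc k) N.+ j
      below rewrite la-eq | NP.+-suc (mu j) k = far sk<rj

    relation-near : r j ≤ s k → entryWith s′ k j ≋ combination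
    relation-near rj≤sk = PS.trans E′≋ (PS.trans recurrence (PS.sym (PS.+-cong (mulPS-congˡ u E≋) (mulPS-congˡ v E₊≋))))
      where
      open RowRecurrence R using (row-recurrence)
      A C′ : ℕ
      A  = la k N.+ j
      C′ = mu j N.+ k
      Ẑ Ŵ X₀ X₁ : PS
      Ẑ  = mulPS (monomial 1# A) (Z k j)
      Ŵ  = mulPS (monomial 1# A) (Z (suc k) j)
      X₁ = X (r j) (s k)
      X₀ = X (r j) (s k ∸ 1)
      sk≡ : suc (s k ∸ 1) ≡ s k
      sk≡ = P.trans (NP.+-comm 1 (s k ∸ 1)) (NP.m∸n+n≡m 1≤sk)
      X-split : X₁ ≋ mulPS (geom (x (s k))) X₀
      X-split = PS.trans (P.subst (λ b → X (r j) b ≋ mulPS X₀ (geom (x b))) sk≡ (X-snoc (P.subst (r j ≤_) (P.sym sk≡) rj≤sk)))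
                         (PS.*-comm X₀ (geom (x (s k))))
      Ẑ-split : Ẑ ≋ mulPS (geom (β k)) Ŵ
      Ẑ-split = PS.trans (mulPS-congˡ (monomial 1# A) (PS.trans (Z-step k j) (mulPS-congʳ (Z (suc k) j) (Q-geom t la-eq))))
                         (solve 3 (λ m g w → m :* (g :* w) := g :* (m :* w)) PS.refl (monomial 1# A) (geom (β k)) (Z (suc k) j))
      recurrence : (λ d → X₀ d * Ẑ (C′ N.+ d)) ≋
                   addPS (mulPS u (λ d → X₁ d * Ẑ (C′ N.+ d))) (mulPS v (λ d → X₁ d * Ŵ (suc C′ N.+ d)))
      recurrence = row-recurrence X₁ X₀ Ẑ Ŵ (x (s k)) (β k) C′
        (trans (X-const-term (r j) (s k)) (sym (X-const-term (r j) (s k ∸ 1))))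
        (λ d → trans (X-split (suc d)) (trans (geom-*-suc (x (s k)) X₀ d) (+-congˡ (*-congˡ (sym (X-split d))))))
        (λ e → trans (Ẑ-split (suc e)) (trans (geom-*-suc (β k) Ŵ e) (+-congˡ (*-congˡ (sym (Ẑ-split e))))))
      E′≋ : entryWith s′ k j ≋ (λ d → X₀ d * Ẑ (C′ N.+ d))
      E′≋ d rewrite P.sym s′k = entry-shift s′ k j d
      E≋ : entryWith s k j ≋ (λ d → X₁ d * Ẑ (C′ N.+ d))
      E≋ = entry-shift s k j
      E₊≋ : entryWith s (suc k) j ≋ (λ d → X₁ d * Ŵ (suc C′ N.+ d))
      E₊≋ d with entry-shift s (suc k) j d
      ... | shifted rewrite s-eq | la-eq | NP.+-suc (mu j) k = shifted

    row-relation : entryWith s′ k j ≋ combination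
    row-relation with s k N.<? r j
    ... | yes sk<rj = relation-far sk<rj
    ... | no sk≮rj  = relation-near (NP.≮⇒≥ sk≮rj)

  entry-scaled : ∀ i j → X (r j) (s i) ≋ geom (x 1) → mu j N.+ i ≤ la i N.+ j →
                 entryWith s i j ≋ scale (x 1) (mulPS (monomial 1# ((la i N.+ j) ∸ (mu j N.+ i))) (Z i j))
  entry-scaled i j X≋geom C≤A d = trans (entry-shift s i j d) (*-cong (X≋geom d) (trans
    (reflexive (P.cong (λ a → mulPS (monomial 1# a) (Z i j) (mu j N.+ i N.+ d)) (P.sym (NP.m∸n+n≡m C≤A))))
    (monomial-drop ((la i N.+ j) ∸ (mu j N.+ i)) (mu j N.+ i) (Z i j) d)))

  offset-split : ∀ a b j μ i → b ≤ a → μ N.+ suc i ≤ b N.+ j →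
                 (suc a ∸ b) N.+ ((b N.+ j) ∸ (μ N.+ suc i)) N.+ (μ N.+ i) ≡ a N.+ j
  offset-split a b j μ i b≤a C₊≤A₊ = NP.suc-injective (begin
    suc (D N.+ m₊ N.+ (μ N.+ i))      ≡⟨ NP.+-suc (D N.+ m₊) (μ N.+ i) ⟨
    D N.+ m₊ N.+ suc (μ N.+ i)        ≡⟨ P.cong (D N.+ m₊ N.+_) (NP.+-suc μ i) ⟨
    D N.+ m₊ N.+ (μ N.+ suc i)        ≡⟨ NP.+-assoc D m₊ (μ N.+ suc i) ⟩
    D N.+ (m₊ N.+ (μ N.+ suc i))      ≡⟨ P.cong (D N.+_) (NP.m∸n+n≡m C₊≤A₊) ⟩
    D N.+ (b N.+ j)                   ≡⟨ NP.+-assoc D b j ⟨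
    D N.+ b N.+ j                     ≡⟨ P.cong (N._+ j) (NP.m∸n+n≡m (NP.m≤n⇒m≤1+n b≤a)) ⟩
    suc a N.+ j                       ∎)
    where
    open P.≡-Reasoning
    D m₊ : ℕ
    D  = suc a ∸ b
    m₊ = (b N.+ j) ∸ (μ N.+ suc i)

  Cf : ℕ → PS
  Cf i = scale (x 1) (mulPS (monomial 1# (suc (la i) ∸ la (suc i))) (Q i))

  entry-step : ∀ i j → X (r j) (s i) ≋ geom (x 1) → X (r j) (s (suc i)) ≋ geom (x 1) →
               la (suc i) ≤ la i → mu j N.+ suc i ≤ la (suc i) N.+ j →
               entryWith s i j ≋ mulPS (Cf i) (entryWith s (suc i) j)
  entry-step i j X≋geom X₊≋geom la₊≤la C₊≤A₊ = begin
    entryWith s i j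
      ≈⟨ entry-scaled i j X≋geom C≤A ⟩
    scale (x 1) (mulPS (monomial 1# m) (Z i j))
      ≈⟨ scale-cong (x 1) (PS.*-cong (≡⇒≋ (P.cong (monomial 1#) m≡D+m₊)) (Z-step i j)) ⟩
    scale (x 1) (mulPS (monomial 1# (D N.+ m₊)) (mulPS (Q i) (Z (suc i) j)))
      ≈⟨ scale-cong (x 1) (PS.trans (mulPS-congʳ (mulPS (Q i) (Z (suc i) j)) (monomial-+ D m₊))
           (solve 4 (λ a b c e → (a :* b) :* (c :* e) := (a :* c) :* (b :* e))
             PS.refl (monomial 1# D) (monomial 1# m₊) (Q i) (Z (suc i) j))) ⟩
    scale (x 1) (mulPS (mulPS (monomial 1# D) (Q i)) (mulPS (monomial 1# m₊) (Z (suc i) j)))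
      ≈⟨ scale-mulPS (x 1) (mulPS (monomial 1# D) (Q i)) (mulPS (monomial 1# m₊) (Z (suc i) j)) ⟩
    mulPS (Cf i) (scale (x 1) (mulPS (monomial 1# m₊) (Z (suc i) j)))
      ≈⟨ mulPS-congˡ (Cf i) (entry-scaled (suc i) j X₊≋geom C₊≤A₊) ⟨
    mulPS (Cf i) (entryWith s (suc i) j) ∎
    where
    open SetoidReasoning PS.setoid
    D m₊ m : ℕ
    D  = suc (la i) ∸ la (suc i)
    m₊ = (la (suc i) N.+ j) ∸ (mu j N.+ suc i)
    m  = (la i N.+ j) ∸ (mu j N.+ i)
    key : D N.+ m₊ N.+ (mu j N.+ i) ≡ la i N.+ j
    key = offset-split (la i) (la (suc i)) j (mu j) i la₊≤la C₊≤A₊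
    C≤A : mu j N.+ i ≤ la i N.+ j
    C≤A = P.subst (mu j N.+ i ≤_) key (NP.m≤n+m (mu j N.+ i) (D N.+ m₊))
    m≡D+m₊ : m ≡ D N.+ m₊
    m≡D+m₊ = P.trans (P.cong (_∸ (mu j N.+ i)) (P.sym key)) (NP.m+n∸n≡m (D N.+ m₊) (mu j N.+ i))

module GtildeRow {c ℓ} (R : CommutativeRing c ℓ) (n : ℕ) (la mu r s : ℕ → ℕ) (t : ℕ) (x α β : ℕ → CommutativeRing.Carrier R)
  (la-part : IsPartition n la) (mu-part : IsPartition n mu) (mu⊆la : Contained n mu la)
  (r-inc : WeakIncPos n r) (s-inc : WeakIncPos n s)
  (k<n : suc t < n) (mu<la : mu (suc t) < la (suc t)) (r≤s : r (suc t) ≤ s (suc t))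
  (s-eq : s (suc t) ≡ s (suc (suc t))) (la-eq : la (suc t) ≡ la (suc (suc t))) where

  open CommutativeRing R using (_*_)
  open WithRing R
  open PowerSeries R
  open PowerSeriesProducts R using (prodPS-concatMap; prodPS-rangeL-update; prodPS-rangeL-snoc)
  open SeriesDeterminant R using (module Det; det≋)
  open Entries R n la mu r s x α β
  open SetoidReasoning PS.setoid

  k : ℕ
  k = suc t

  s′ : ℕ → ℕ
  s′ = minusUnit s k

  k≤n : k ≤ n
  k≤n = NP.<⇒≤ k<n

  1≤sk : 1 ≤ s k
  1≤sk = proj₁ s-inc k (s≤s z≤n) k≤n

  u v : PS
  u = oneMinus (β k * x (s k))
  v = negPS (monomial (x (s k)) 1)

  far-columns : ∀ j → 1 ≤ j → j ≤ n → s k < r j → suc (mu j N.+ k) < la k N.+ j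
  far-columns j 1≤j j≤n sk<rj with j ≤? k
  ... | yes j≤k = ⊥-elim (NP.<⇒≱ sk<rj (NP.≤-trans (WeakIncPos-monotone r-inc 1≤j j≤k k≤n) r≤s))
  ... | no j≰k with j N.≟ suc k
  ...   | yes P.refl = P.subst (_< la k N.+ suc k) (NP.+-suc (mu (suc k)) k)
                         (NP.+-monoˡ-< (suc k) (NP.≤-<-trans (mu-part k (s≤s z≤n) k<n) mu<la))
  ...   | no j≢1+k   = P.subst (_< la k N.+ j) (NP.+-suc (mu j) k)
                         (NP.+-mono-≤-< (NP.≤-trans (mu⊆la j 1≤j j≤n) (IsPartition-antitone la-part (s≤s z≤n) (NP.<⇒≤ (NP.≰⇒> j≰k)) j≤n))
                                        (NP.≤∧≢⇒< (NP.≰⇒> j≰k) (j≢1+k ∘ P.sym)))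

  E E′ : ℕ → ℕ → PS
  E  i j = entryWith s (suc i) (suc j)
  E′ i j = entryWith s′ (suc i) (suc j)

  det-relation : det n (Det.matrix n E′) ≋ mulPS u (det n (Det.matrix n E))
  det-relation = begin
    det n (Det.matrix n E′)               ≈⟨ det≋ n (Det.matrix n E′) ⟩
    Det.det n (Det.matrix n E′)           ≈⟨ Det.det-row-combination n E E′ t u v k<n
                                               (λ i j _ _ i≢t → entry-cong-s s′ s (suc i) (suc j) (minusUnit-≢ s k (i≢t ∘ NP.suc-injective)))
                                               (λ j j<n → RowRelation.row-relation t (suc j) s′ 1≤sk (P.sym la-eq) (P.sym s-eq) (minusUnit-≡ s k)
                                                            (far-columns (suc j) (s≤s z≤n) j<n)) ⟩
    mulPS u (Det.det n (Det.matrix n E))  ≈⟨ mulPS-congˡ u (det≋ n (Det.matrix n E)) ⟨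
    mulPS u (det n (Det.matrix n E))      ∎

  rowFactor : ℕ → ℕ → PS
  rowFactor i b = prodPS (map (λ l → oneMinus (β i * x l)) (rangeL (r i) b))

  rowFactor-k : rowFactor k (s k) ≋ mulPS (rowFactor k (s′ k)) u
  rowFactor-k rewrite minusUnit-≡ s k =
    P.subst (λ b → rowFactor k b ≋ mulPS (rowFactor k (s k ∸ 1)) (oneMinus (β k * x b))) sk≡
      (prodPS-rangeL-snoc (λ l → oneMinus (β k * x l)) (P.subst (r k ≤_) (P.sym sk≡) r≤s))
    where
    sk≡ : suc (s k ∸ 1) ≡ s k
    sk≡ = P.trans (NP.+-comm 1 (s k ∸ 1)) (NP.m∸n+n≡m 1≤sk)

  prefactor-relation : prefactor n la mu r s x α β ≋ mulPS (prefactor n la mu r s′ x α β) u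
  prefactor-relation = begin
    prefactor n la mu r s x α β                                ≈⟨ prodPS-concatMap (factors s) (rangeL 1 n) ⟩
    prodPS (map (λ i → rowFactor i (s i)) (rangeL 1 n))        ≈⟨ prodPS-rangeL-update (λ i → rowFactor i (s i)) (λ i → rowFactor i (s′ i)) u
                                                                    (λ i i≢k → ≡⇒≋ (P.cong (rowFactor i) (P.sym (minusUnit-≢ s k i≢k))))
                                                                    rowFactor-k (s≤s z≤n) k≤n ⟩
    mulPS (prodPS (map (λ i → rowFactor i (s′ i)) (rangeL 1 n))) u ≈⟨ mulPS-congʳ u (prodPS-concatMap (factors s′) (rangeL 1 n)) ⟨
    mulPS (prefactor n la mu r s′ x α β) u                     ∎
    where
    factors : (ℕ → ℕ) → ℕ → List PS
    factors s₀ i = map (λ l → oneMinus (β i * x l)) (rangeL (r i) (s₀ i))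

  Gtilde-minusUnit : Gtilde n la mu r s x α β ≋ Gtilde n la mu r s′ x α β
  Gtilde-minusUnit = begin
    mulPS (prefactor n la mu r s x α β) D                      ≈⟨ mulPS-congʳ D prefactor-relation ⟩
    mulPS (mulPS (prefactor n la mu r s′ x α β) u) D           ≈⟨ PS.*-assoc (prefactor n la mu r s′ x α β) u D ⟩
    mulPS (prefactor n la mu r s′ x α β) (mulPS u D)           ≈⟨ mulPS-congˡ (prefactor n la mu r s′ x α β) det-relation ⟨
    mulPS (prefactor n la mu r s′ x α β) (det n (Det.matrix n E′)) ∎
    where
    D : PS
    D = det n (Det.matrix n E)

  module _ (sk≡1 : s k ≡ 1) where

    s≡1 : ∀ {I} → 1 ≤ I → I ≤ suc k → s I ≡ 1
    s≡1 {I} 1≤I I≤1+k = NP.≤-antisym (P.subst (s I ≤_) sk≡1 sI≤sk) (proj₁ s-inc I 1≤I (NP.≤-trans I≤1+k k<n))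
      where
      sI≤sk : s I ≤ s k
      sI≤sk with I N.≟ suc k
      ... | yes P.refl = NP.≤-reflexive (P.sym s-eq)
      ... | no I≢1+k   = WeakIncPos-monotone s-inc 1≤I (NP.≤-pred (NP.≤∧≢⇒< I≤1+k I≢1+k)) k≤n

    rk≡1 : r k ≡ 1
    rk≡1 = NP.≤-antisym (P.subst (r k ≤_) sk≡1 r≤s) (proj₁ r-inc k (s≤s z≤n) k≤n)

    rows-reduce : ∀ i j → i ≤ t → t ≤ j → j < n → addPS (E i j) (mulPS (negPS (Cf (suc i))) (E (suc i) j)) ≋ zeroPS
    rows-reduce i j i≤t t≤j j<n = reduce-at (r J ≤? 1)
      where
      I J : ℕ
      I = suc i
      J = suc j
      I≤k : I ≤ k
      I≤k = s≤s i≤t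
      k≤J : k ≤ J
      k≤J = s≤s t≤j
      sI≡1 : s I ≡ 1
      sI≡1 = s≡1 (s≤s z≤n) (NP.m≤n⇒m≤1+n I≤k)
      sI₊≡1 : s (suc I) ≡ 1
      sI₊≡1 = s≡1 (s≤s z≤n) (s≤s I≤k)
      la₊≤la : la (suc I) ≤ la I
      la₊≤la = la-part I (s≤s z≤n) (NP.≤-<-trans I≤k k<n)
      muJ<la₊ : mu J < la (suc I)
      muJ<la₊ = NP.≤-<-trans (IsPartition-antitone mu-part (s≤s z≤n) k≤J j<n)
        (NP.<-≤-trans mu<la (NP.≤-trans (NP.≤-reflexive la-eq) (IsPartition-antitone la-part (s≤s z≤n) (s≤s I≤k) k<n)))
      V : PS
      V = negPS (Cf I)
      reduce-at : Dec (r J ≤ 1) → addPS (E i j) (mulPS V (E (suc i) j)) ≋ zeroPS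
      reduce-at (yes rJ≤1) = begin
        addPS (E i j) (mulPS V (E (suc i) j))
          ≈⟨ PS.+-cong (entry-step I J (X≋geom sI≡1) (X≋geom sI₊≡1) la₊≤la C₊≤A₊) (PS.sym (negPS-distribˡ-mulPS (Cf I) (E (suc i) j))) ⟩
        addPS (mulPS (Cf I) (E (suc i) j)) (negPS (mulPS (Cf I) (E (suc i) j)))
          ≈⟨ PS.-‿inverseʳ (mulPS (Cf I) (E (suc i) j)) ⟩
        zeroPS ∎
        where
        X≋geom : ∀ {b} → b ≡ 1 → X (r J) b ≋ geom (x 1)
        X≋geom P.refl = P.subst (λ a → X a 1 ≋ geom (x 1)) (P.sym (NP.≤-antisym rJ≤1 (proj₁ r-inc J (s≤s z≤n) j<n))) X-single
        C₊≤A₊ : mu J N.+ suc I ≤ la (suc I) N.+ J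
        C₊≤A₊ = P.subst (_≤ la (suc I) N.+ J) (P.sym (NP.+-suc (mu J) I)) (NP.+-mono-≤ muJ<la₊ (NP.≤-trans I≤k k≤J))
      reduce-at (no rJ≰1) = PS.trans
        (PS.+-cong (entry-vanishes s I J (X≋1 sI≡1) (NP.+-mono-<-≤ (NP.<-≤-trans muJ<la₊ la₊≤la) (NP.≤-trans I≤k k≤J)))
                   (PS.trans (mulPS-congˡ V (entry-vanishes s (suc I) J (X≋1 sI₊≡1) (NP.+-mono-<-≤ muJ<la₊ 1+I≤J))) (PS.zeroʳ V)))
        (PS.+-identityʳ zeroPS)
        where
        X≋1 : ∀ {b} → b ≡ 1 → X (r J) b ≋ onePS
        X≋1 P.refl = X-empty (NP.≰⇒> rJ≰1)
        1+I≤J : suc I ≤ J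
        1+I≤J = NP.≤-trans (s≤s I≤k) (NP.≤∧≢⇒< k≤J λ k≡J → rJ≰1 (P.subst (λ z → r z ≤ 1) k≡J (NP.≤-reflexive rk≡1)))

    Gtilde-vanishes : Gtilde n la mu r s′ x α β ≋ zeroPS
    Gtilde-vanishes = begin
      Gtilde n la mu r s′ x α β                                   ≈⟨ Gtilde-minusUnit ⟨
      mulPS (prefactor n la mu r s x α β) (det n (Det.matrix n E)) ≈⟨ mulPS-congˡ (prefactor n la mu r s x α β) det≋0 ⟩
      mulPS (prefactor n la mu r s x α β) zeroPS                   ≈⟨ PS.zeroʳ (prefactor n la mu r s x α β) ⟩
      zeroPS                                                       ∎
      where
      det≋0 : det n (Det.matrix n E) ≋ zeroPS
      det≋0 = PS.trans (det≋ n (Det.matrix n E)) (Det.det-≈0-by-row-reduction n E (λ i → negPS (Cf (suc i))) t k<n rows-reduce)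

module Tableaux where

  allB-sound : ∀ {A : Set} (p : A → Bool) L → T (allB p L) → ∀ {a} → a ∈ L → T (p a)
  allB-sound p (b ∷ L) all (here P.refl) = proj₁ (Equivalence.to (T-∧ {p b}) all)
  allB-sound p (b ∷ L) all (there a∈L)   = allB-sound p L (proj₂ (Equivalence.to (T-∧ {p b}) all)) a∈L

  allB-complete : ∀ {A : Set} (p : A → Bool) L → (∀ {a} → a ∈ L → T (p a)) → T (allB p L)
  allB-complete p []      _   = tt
  allB-complete p (b ∷ L) all = Equivalence.from (T-∧ {p b}) (all (here P.refl) , allB-complete p L (all ∘ there))

  rowCells : (ℕ → ℕ) → (ℕ → ℕ) → ℕ → List (ℕ × ℕ)
  rowCells la mu i = map (λ j → (i , j)) (rangeL (suc (mu i)) (la i))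

  ∈-cells⁻ : ∀ {n la mu i j} → (i , j) ∈ cells n la mu → (1 ≤ i × i ≤ n) × (mu i < j × j ≤ la i)
  ∈-cells⁻ {n} {la} {mu} ij∈
    with i , i∈ , ij∈row ← find (∈P.∈-concatMap⁻ (rowCells la mu) {xs = rangeL 1 n} ij∈)
    with j , j∈ , P.refl ← ∈P.∈-map⁻ (λ j → (i , j)) ij∈row
    = ∈-rangeL⁻ i∈ , ∈-rangeL⁻ j∈

  ∈-cells⁺ : ∀ {n la mu i j} → 1 ≤ i → i ≤ n → mu i < j → j ≤ la i → (i , j) ∈ cells n la mu
  ∈-cells⁺ {n} {la} {mu} {i} {j} 1≤i i≤n mu<j j≤la =
    ∈P.∈-concatMap⁺ (rowCells la mu) {xs = rangeL 1 n}
      (lose (∈-rangeL⁺ 1≤i i≤n) (∈P.∈-map⁺ (λ j → (i , j)) (∈-rangeL⁺ mu<j j≤la)))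

  zip-keys : ∀ (cs : List (ℕ × ℕ)) (Fl : List Content) → length Fl ≡ length cs → map proj₁ (zip cs Fl) ≡ cs
  zip-keys []       Fl       _   = P.refl
  zip-keys (c ∷ cs) (w ∷ Fl) len = P.cong (c ∷_) (zip-keys cs Fl (NP.suc-injective len))

  ∈-zip-key : ∀ (cs : List (ℕ × ℕ)) (Fl : List Content) {e} → e ∈ zip cs Fl → proj₁ e ∈ cs
  ∈-zip-key (c ∷ cs) (w ∷ Fl) (here P.refl) = here P.refl
  ∈-zip-key (c ∷ cs) (w ∷ Fl) (there e∈)    = there (∈-zip-key cs Fl e∈)

  Any-zip : ∀ (cs : List (ℕ × ℕ)) (Fl : List Content) {Q : Content → Set} →
            length Fl ≡ length cs → Any Q Fl → Any (Q ∘ proj₂) (zip cs Fl)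
  Any-zip (c ∷ cs) (w ∷ Fl) len (here q)  = here q
  Any-zip (c ∷ cs) (w ∷ Fl) len (there q) = there (Any-zip cs Fl (NP.suc-injective len) q)

  lookupCell-∈ : ∀ (T′ : Filling) i j {w} → lookupCell T′ i j ≡ just w → ((i , j) , w) ∈ T′
  lookupCell-∈ (((i′ , j′) , w′) ∷ T′) i j found with (i ≡ᵇ i′) ∧ (j ≡ᵇ j′) in same
  ... | false = there (lookupCell-∈ T′ i j found)
  ... | true with Equivalence.to (T-∧ {i ≡ᵇ i′}) (P.subst T (P.sym same) tt)
  ...   | i≡ᵇi′ , j≡ᵇj′ with NP.≡ᵇ⇒≡ i i′ i≡ᵇi′ | NP.≡ᵇ⇒≡ j j′ j≡ᵇj′ | found
  ...     | P.refl | P.refl | P.refl = here P.refl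

  lookupCell-defined : ∀ (T′ : Filling) i j → (i , j) ∈ map proj₁ T′ → ∃ λ w → lookupCell T′ i j ≡ just w
  lookupCell-defined (((i′ , j′) , w′) ∷ T′) i j ij∈ with (i ≡ᵇ i′) ∧ (j ≡ᵇ j′) in same
  ... | true = w′ , P.refl
  ... | false with ij∈
  ...   | here P.refl = ⊥-elim (P.subst T same (Equivalence.from (T-∧ {i ≡ᵇ i}) (≡ᵇ-refl i , ≡ᵇ-refl j)))
  ...   | there ij∈′  = lookupCell-defined T′ i j ij∈′

  ≤-maxC : ∀ (w : Content) {a b} → (a , b) ∈ w → a ≤ maxC w
  ≤-maxC ((a , b) ∷ w) (here P.refl) = NP.m≤m⊔n a (maxC w)
  ≤-maxC (p ∷ w)       (there a∈w)   = NP.≤-trans (≤-maxC w a∈w) (NP.m≤n⊔m (proj₁ p) (maxC w))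

  minC≤maxC : ∀ (w : Content) → T (cellOK w) → minC w ≤ maxC w
  minC≤maxC ((a , b) ∷ w) _ = NP.≤-trans (foldr-⊓≤ a w) (NP.m≤m⊔n a (maxC w))
    where
    foldr-⊓≤ : ∀ a (w : Content) → foldr (λ p m → proj₁ p ⊓ m) a w ≤ a
    foldr-⊓≤ a []      = NP.≤-refl
    foldr-⊓≤ a (p ∷ w) = NP.≤-trans (NP.m⊓n≤n (proj₁ p) _) (foldr-⊓≤ a w)

  -- validT r s T′ unfolds to allB (cellValid r s T′) T′.
  cellValid : (ℕ → ℕ) → (ℕ → ℕ) → Filling → (ℕ × ℕ) × Content → Bool
  cellValid r s T′ ((i , j) , w) = cellOK w ∧ (r i ≤ᵇ minC w) ∧ (maxC w ≤ᵇ s i)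
                                  ∧ rowCond w (lookupCell T′ i (suc j)) ∧ colCond w (lookupCell T′ (suc i) j)

  record ValidCell (r s : ℕ → ℕ) (T′ : Filling) (i j : ℕ) (w : Content) : Set where
    field
      nonempty  : T (cellOK w)
      lower     : r i ≤ minC w
      upper     : maxC w ≤ s i
      rowWeak   : T (rowCond w (lookupCell T′ i (suc j)))
      colStrict : T (colCond w (lookupCell T′ (suc i) j))

  validCell⁻ : ∀ r s T′ {i j w} → T (cellValid r s T′ ((i , j) , w)) → ValidCell r s T′ i j w
  validCell⁻ r s T′ {i} {j} {w} ok
    with ok₁ , ok₂ ← Equivalence.to (T-∧ {cellOK w}) ok
    with ok₂ , ok₃ ← Equivalence.to (T-∧ {r i ≤ᵇ minC w}) ok₂
    with ok₃ , ok₄ ← Equivalence.to (T-∧ {maxC w ≤ᵇ s i}) ok₃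
    with ok₄ , ok₅ ← Equivalence.to (T-∧ {rowCond w (lookupCell T′ i (suc j))}) ok₄
    = record { nonempty = ok₁ ; lower = NP.≤ᵇ⇒≤ _ _ ok₂ ; upper = NP.≤ᵇ⇒≤ _ _ ok₃ ; rowWeak = ok₄ ; colStrict = ok₅ }

  validCell⁺ : ∀ r s T′ {i j w} → ValidCell r s T′ i j w → T (cellValid r s T′ ((i , j) , w))
  validCell⁺ r s T′ {i} {j} {w} v = Equivalence.from (T-∧ {cellOK w}) (nonempty ,
    Equivalence.from (T-∧ {r i ≤ᵇ minC w}) (NP.≤⇒≤ᵇ lower ,
    Equivalence.from (T-∧ {maxC w ≤ᵇ s i}) (NP.≤⇒≤ᵇ upper ,
    Equivalence.from (T-∧ {rowCond w (lookupCell T′ i (suc j))}) (rowWeak , colStrict))))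
    where open ValidCell v

  ValidCell-rebound : ∀ {r s s′ T′ i j w} → ValidCell r s T′ i j w → maxC w ≤ s′ i → ValidCell r s′ T′ i j w
  ValidCell-rebound v max≤s′ = record
    { nonempty = nonempty ; lower = lower ; upper = max≤s′ ; rowWeak = rowWeak ; colStrict = colStrict }
    where open ValidCell v

  validT⇒ValidCell : ∀ r s T′ → T (validT r s T′) → ∀ {i j w} → ((i , j) , w) ∈ T′ → ValidCell r s T′ i j w
  validT⇒ValidCell r s T′ valid e∈ = validCell⁻ r s T′ (allB-sound (cellValid r s T′) T′ valid e∈)

  ValidCell⇒validT : ∀ r s T′ → (∀ {i j w} → ((i , j) , w) ∈ T′ → ValidCell r s T′ i j w) → T (validT r s T′)
  ValidCell⇒validT r s T′ cellsValid = allB-complete (cellValid r s T′) T′ (λ {e} e∈ → validCell⁺ r s T′ (cellsValid e∈))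

  module Row (n : ℕ) (la mu : ℕ → ℕ) (k : ℕ) (mu-part : IsPartition n mu)
             (1≤k : 1 ≤ k) (k<n : k < n) (mu<la : mu k < la k) (la-eq : la k ≡ la (suc k))
             (Fl : List Content) (len : length Fl ≡ length (cells n la mu)) where

    T′ : Filling
    T′ = zip (cells n la mu) Fl

    cell-content : ∀ {i j} → (i , j) ∈ cells n la mu → ∃ λ w → lookupCell T′ i j ≡ just w
    cell-content {i} {j} ij∈ = lookupCell-defined T′ i j (P.subst ((i , j) ∈_) (P.sym (zip-keys (cells n la mu) Fl len)) ij∈)

    cell-shape : ∀ {i j w} → ((i , j) , w) ∈ T′ → (1 ≤ i × i ≤ n) × (mu i < j × j ≤ la i)
    cell-shape e∈ = ∈-cells⁻ (∈-zip-key (cells n la mu) Fl e∈)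

    row-bounded : ∀ r s₀ → T (validT r s₀ T′) → ∀ {j w} → ((k , j) , w) ∈ T′ → maxC w < s₀ (suc k)
    row-bounded r s₀ valid {j} kj∈ = walk (la k ∸ j) P.refl kj∈
      where
      walk : ∀ {j w} m → la k ∸ j ≡ m → ((k , j) , w) ∈ T′ → maxC w < s₀ (suc k)
      walk {j} {w} zero la∸j≡0 kj∈ = down (cell-content (∈-cells⁺ (s≤s z≤n) k<n mu₊<j (P.subst (j ≤_) la-eq (NP.≤-reflexive j≡la))))
        where
        j≡la : j ≡ la k
        j≡la = NP.≤-antisym (proj₂ (proj₂ (cell-shape kj∈))) (NP.m∸n≡0⇒m≤n la∸j≡0)
        mu₊<j : mu (suc k) < j
        mu₊<j = NP.≤-<-trans (mu-part k 1≤k k<n) (P.subst (mu k <_) (P.sym j≡la) mu<la)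
        this : ValidCell r s₀ T′ k j w
        this = validT⇒ValidCell r s₀ T′ valid kj∈
        down : (∃ λ w₊ → lookupCell T′ (suc k) j ≡ just w₊) → maxC w < s₀ (suc k)
        down (w₊ , found) = NP.<-≤-trans (NP.<ᵇ⇒< _ _ (P.subst (T ∘ colCond w) found (ValidCell.colStrict this)))
                              (NP.≤-trans (minC≤maxC w₊ (ValidCell.nonempty below)) (ValidCell.upper below))
          where
          below : ValidCell r s₀ T′ (suc k) j w₊
          below = validT⇒ValidCell r s₀ T′ valid (lookupCell-∈ T′ (suc k) j found)
      walk {j} {w} (suc m) la∸j≡1+m kj∈ = right (cell-content (∈-cells⁺ 1≤k (NP.<⇒≤ k<n) (NP.<-trans mu<j (NP.n<1+n j)) j<la))
        where
        mu<j : mu k < j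
        mu<j = proj₁ (proj₂ (cell-shape kj∈))
        j<la : j < la k
        j<la = NP.≤∧≢⇒< (proj₂ (proj₂ (cell-shape kj∈))) λ j≡la →
                 NP.0≢1+n (P.trans (P.sym (P.trans (P.cong (la k ∸_) j≡la) (NP.n∸n≡0 (la k)))) la∸j≡1+m)
        this : ValidCell r s₀ T′ k j w
        this = validT⇒ValidCell r s₀ T′ valid kj∈
        right : (∃ λ w′ → lookupCell T′ k (suc j) ≡ just w′) → maxC w < s₀ (suc k)
        right (w′ , found) = NP.≤-<-trans (NP.≤-trans (NP.≤ᵇ⇒≤ _ _ (P.subst (T ∘ rowCond w) found (ValidCell.rowWeak this)))
                                                     (minC≤maxC w′ (ValidCell.nonempty next)))
                                        (walk m (NP.suc-injective (P.trans (P.sym (NP.+-∸-assoc 1 j<la)) la∸j≡1+m)) next∈)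
          where
          next∈ : ((k , suc j) , w′) ∈ T′
          next∈ = lookupCell-∈ T′ k (suc j) found
          next : ValidCell r s₀ T′ k (suc j) w′
          next = validT⇒ValidCell r s₀ T′ valid next∈

    validT-minusUnit : ∀ r s → s k ≡ s (suc k) → validT r s T′ ≡ validT r (minusUnit s k) T′
    validT-minusUnit r s s-eq = T-injective lower-row upper-row
      where
      lower-row : T (validT r s T′) → T (validT r (minusUnit s k) T′)
      lower-row valid = ValidCell⇒validT r (minusUnit s k) T′ λ {i} {j} {w} e∈ →
        let v = validT⇒ValidCell r s T′ valid e∈ in ValidCell-rebound v (tightened e∈ (ValidCell.upper v))
        where
        tightened : ∀ {i j w} → ((i , j) , w) ∈ T′ → maxC w ≤ s i → maxC w ≤ minusUnit s k i
        tightened {i} {j} {w} e∈ max≤s with i N.≟ k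
        ... | yes P.refl = P.subst (maxC w ≤_) (P.sym (minusUnit-≡ s k))
                             (NP.<⇒≤pred (P.subst (maxC w <_) (P.sym s-eq) (row-bounded r s valid e∈)))
        ... | no i≢k     = P.subst (maxC w ≤_) (P.sym (minusUnit-≢ s k i≢k)) max≤s
      upper-row : T (validT r (minusUnit s k) T′) → T (validT r s T′)
      upper-row valid = ValidCell⇒validT r s T′ λ {i} {j} {w} e∈ →
        let v = validT⇒ValidCell r (minusUnit s k) T′ valid e∈ in ValidCell-rebound v (NP.≤-trans (ValidCell.upper v) (minusUnit-≤ s k i))

    no-valid : ∀ r s₀ → s₀ k ≡ 0 → 1 ≤ r k → ¬ T (validT r s₀ T′)
    no-valid r s₀ s₀k≡0 1≤rk valid with cell-content (∈-cells⁺ 1≤k (NP.<⇒≤ k<n) mu<la NP.≤-refl)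
    ... | w , found = NP.<⇒≱ 1≤rk (NP.≤-trans (ValidCell.lower v) (NP.≤-trans (minC≤maxC w (ValidCell.nonempty v))
                                   (NP.≤-trans (ValidCell.upper v) (NP.≤-reflexive s₀k≡0))))
      where
      v : ValidCell r s₀ T′ k (la k) w
      v = validT⇒ValidCell r s₀ T′ valid (lookupCell-∈ T′ k (la k) found)

  HasEntryAbove : ℕ → List Content → Set
  HasEntryAbove N = Any (Any (λ p → N < proj₁ p))

  entry-above⇒invalid : ∀ n la mu r s₀ N (Fl : List Content) → length Fl ≡ length (cells n la mu) →
    (∀ i → 1 ≤ i → i ≤ n → s₀ i ≤ N) → HasEntryAbove N Fl → ¬ T (validT r s₀ (zip (cells n la mu) Fl))
  entry-above⇒invalid n la mu r s₀ N Fl len s₀≤N above valid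
    with ((i , j) , w) , e∈ , w-above ← find (Any-zip (cells n la mu) Fl len above)
    with (a , _) , a∈w , N<a ← find w-above
    = NP.<⇒≱ N<a (NP.≤-trans (≤-maxC w a∈w) (NP.≤-trans (ValidCell.upper (validT⇒ValidCell r s₀ _ valid e∈))
                                                         (s₀≤N i (proj₁ row-range) (proj₂ row-range))))
    where
    row-range : 1 ≤ i × i ≤ n
    row-range = proj₁ (∈-cells⁻ (∈-zip-key (cells n la mu) Fl e∈))

  fills-length : ∀ N c d {Fl} → Fl ∈ fills N c d → length Fl ≡ c
  fills-length N zero    zero    (here P.refl) = P.refl
  fills-length N (suc c) d       Fl∈
    with k , _ , Fl∈k ← find (∈P.∈-concatMap⁻ (λ k → concatMap (λ w → map (w ∷_) (fills N c (d ∸ k))) (words N k))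
                               {xs = rangeL 1 d} Fl∈)
    with w , _ , Fl∈w ← find (∈P.∈-concatMap⁻ (λ w → map (w ∷_) (fills N c (d ∸ k))) {xs = words N k} Fl∈k)
    with Fl′ , Fl′∈ , P.refl ← ∈P.∈-map⁻ (w ∷_) Fl∈w
    = P.cong suc (fills-length N c (d ∸ k) Fl′∈)

module TableauSums {c ℓ} (R : CommutativeRing c ℓ) where

  open CommutativeRing R
  open WithRing R using (sumL)
  open Tableaux using (HasEntryAbove; fills-length)
  open SetoidReasoning setoid

  sumL-++ : ∀ {A : Set} (g : A → Carrier) xs ys → sumL (map g (xs ++ ys)) ≈ sumL (map g xs) + sumL (map g ys)
  sumL-++ g []       ys = sym (+-identityˡ _)
  sumL-++ g (a ∷ xs) ys = trans (+-congˡ (sumL-++ g xs ys)) (sym (+-assoc _ _ _))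

  sumL-concatMap : ∀ {A B : Set} (g : B → Carrier) (F : A → List B) xs →
                   sumL (map g (concatMap F xs)) ≈ sumL (map (λ a → sumL (map g (F a))) xs)
  sumL-concatMap g F []       = refl
  sumL-concatMap g F (a ∷ xs) = trans (sumL-++ g (F a) (concatMap F xs)) (+-congˡ (sumL-concatMap g F xs))

  sumL-map : ∀ {A B : Set} (g : B → Carrier) (h : A → B) xs → sumL (map g (map h xs)) ≈ sumL (map (g ∘ h) xs)
  sumL-map g h []       = refl
  sumL-map g h (a ∷ xs) = +-congˡ (sumL-map g h xs)

  sumL-cong : ∀ {A : Set} {g h : A → Carrier} xs → (∀ {a} → a ∈ xs → g a ≈ h a) → sumL (map g xs) ≈ sumL (map h xs)
  sumL-cong []       g≈h = refl
  sumL-cong (a ∷ xs) g≈h = +-cong (g≈h (here P.refl)) (sumL-cong xs (g≈h ∘ there))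

  sumL-zero : ∀ {A : Set} {g : A → Carrier} xs → (∀ {a} → a ∈ xs → g a ≈ 0#) → sumL (map g xs) ≈ 0#
  sumL-zero []       g≈0 = refl
  sumL-zero (a ∷ xs) g≈0 = trans (+-cong (g≈0 (here P.refl)) (sumL-zero xs (g≈0 ∘ there))) (+-identityˡ 0#)

  words-suc : ∀ k N (h : Content → Carrier) → (∀ w → Any (λ p → N < proj₁ p) w → h w ≈ 0#) →
              sumL (map h (words (suc N) k)) ≈ sumL (map h (words N k))
  words-suc zero    N h h≈0 = refl
  words-suc (suc k) N h h≈0 = begin
    sumL (map h (words (suc N) (suc k)))
      ≈⟨ sumL-concatMap h (startingWith (suc N)) (rangeL 1 (suc N)) ⟩
    sumL (map (λ v → sumL (map h (startingWith (suc N) v))) (rangeL 1 (suc N)))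
      ≈⟨ sumL-cong (rangeL 1 (suc N)) (λ {v} _ → shorter v) ⟩
    sumL (map (λ v → sumL (map h (startingWith N v))) (rangeL 1 (suc N)))
      ≈⟨ reflexive (P.cong (λ L → sumL (map (λ v → sumL (map h (startingWith N v))) L)) (rangeL-snoc {1} {N} (s≤s z≤n))) ⟩
    sumL (map (λ v → sumL (map h (startingWith N v))) (rangeL 1 N ++ (suc N ∷ [])))
      ≈⟨ sumL-++ (λ v → sumL (map h (startingWith N v))) (rangeL 1 N) (suc N ∷ []) ⟩
    sumL (map (λ v → sumL (map h (startingWith N v))) (rangeL 1 N)) + (sumL (map h (startingWith N (suc N))) + 0#)
      ≈⟨ +-congˡ (trans (+-identityʳ _) (sumL-zero (startingWith N (suc N)) top≈0)) ⟩
    sumL (map (λ v → sumL (map h (startingWith N v))) (rangeL 1 N)) + 0#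
      ≈⟨ trans (+-identityʳ _) (sym (sumL-concatMap h (startingWith N) (rangeL 1 N))) ⟩
    sumL (map h (words N (suc k))) ∎
    where
    startingWith : ℕ → ℕ → List Content
    startingWith M v = concatMap (λ b → map ((v , b) ∷_) (words M k)) (true ∷ false ∷ [])
    shorter : ∀ v → sumL (map h (startingWith (suc N) v)) ≈ sumL (map h (startingWith N v))
    shorter v = begin
      sumL (map h (startingWith (suc N) v))
        ≈⟨ sumL-concatMap h (λ b → map ((v , b) ∷_) (words (suc N) k)) (true ∷ false ∷ []) ⟩
      sumL (map (λ b → sumL (map h (map ((v , b) ∷_) (words (suc N) k)))) (true ∷ false ∷ []))
        ≈⟨ sumL-cong (true ∷ false ∷ []) (λ {b} _ → begin
             sumL (map h (map ((v , b) ∷_) (words (suc N) k)))  ≈⟨ sumL-map h ((v , b) ∷_) (words (suc N) k) ⟩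
             sumL (map (h ∘ ((v , b) ∷_)) (words (suc N) k))    ≈⟨ words-suc k N (h ∘ ((v , b) ∷_)) (λ w above → h≈0 _ (there above)) ⟩
             sumL (map (h ∘ ((v , b) ∷_)) (words N k))          ≈⟨ sumL-map h ((v , b) ∷_) (words N k) ⟨
             sumL (map h (map ((v , b) ∷_) (words N k)))        ∎) ⟩
      sumL (map (λ b → sumL (map h (map ((v , b) ∷_) (words N k)))) (true ∷ false ∷ []))
        ≈⟨ sumL-concatMap h (λ b → map ((v , b) ∷_) (words N k)) (true ∷ false ∷ []) ⟨
      sumL (map h (startingWith N v)) ∎
    top≈0 : ∀ {w} → w ∈ startingWith N (suc N) → h w ≈ 0#
    top≈0 w∈
      with b , _ , w∈b ← find (∈P.∈-concatMap⁻ (λ b → map ((suc N , b) ∷_) (words N k)) {xs = true ∷ false ∷ []} w∈)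
      with w′ , _ , P.refl ← ∈P.∈-map⁻ ((suc N , b) ∷_) w∈b
      = h≈0 _ (here (NP.n<1+n N))

  fills-suc : ∀ c N d (g : List Content → Carrier) → (∀ Fl → length Fl ≡ c → HasEntryAbove N Fl → g Fl ≈ 0#) →
              sumL (map g (fills (suc N) c d)) ≈ sumL (map g (fills N c d))
  fills-suc zero    N zero    g g≈0 = refl
  fills-suc zero    N (suc d) g g≈0 = refl
  fills-suc (suc c) N d       g g≈0 = begin
    sumL (map g (fills (suc N) (suc c) d))
      ≈⟨ sumL-concatMap g (withFirst (suc N)) (rangeL 1 d) ⟩
    sumL (map (λ k → sumL (map g (withFirst (suc N) k))) (rangeL 1 d))
      ≈⟨ sumL-cong (rangeL 1 d) (λ {k} _ → shorter k) ⟩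
    sumL (map (λ k → sumL (map g (withFirst N k))) (rangeL 1 d))
      ≈⟨ sumL-concatMap g (withFirst N) (rangeL 1 d) ⟨
    sumL (map g (fills N (suc c) d)) ∎
    where
    withFirst : ℕ → ℕ → List (List Content)
    withFirst M k = concatMap (λ w → map (w ∷_) (fills M c (d ∸ k))) (words M k)
    rest : ℕ → Content → Carrier
    rest k w = sumL (map (g ∘ (w ∷_)) (fills N c (d ∸ k)))
    shorter : ∀ k → sumL (map g (withFirst (suc N) k)) ≈ sumL (map g (withFirst N k))
    shorter k = begin
      sumL (map g (withFirst (suc N) k))
        ≈⟨ sumL-concatMap g (λ w → map (w ∷_) (fills (suc N) c (d ∸ k))) (words (suc N) k) ⟩
      sumL (map (λ w → sumL (map g (map (w ∷_) (fills (suc N) c (d ∸ k))))) (words (suc N) k))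
        ≈⟨ sumL-cong (words (suc N) k) (λ {w} _ → trans (sumL-map g (w ∷_) (fills (suc N) c (d ∸ k)))
             (fills-suc c N (d ∸ k) (g ∘ (w ∷_)) (λ Fl len above → g≈0 (w ∷ Fl) (P.cong suc len) (there above)))) ⟩
      sumL (map (rest k) (words (suc N) k))
        ≈⟨ words-suc k N (rest k) (λ w above → sumL-zero (fills N c (d ∸ k))
             (λ Fl∈ → g≈0 (w ∷ _) (P.cong suc (fills-length N c (d ∸ k) Fl∈)) (here above))) ⟩
      sumL (map (rest k) (words N k))
        ≈⟨ sumL-cong (words N k) (λ {w} _ → sym (sumL-map g (w ∷_) (fills N c (d ∸ k)))) ⟩
      sumL (map (λ w → sumL (map g (map (w ∷_) (fills N c (d ∸ k))))) (words N k))
        ≈⟨ sumL-concatMap g (λ w → map (w ∷_) (fills N c (d ∸ k))) (words N k) ⟨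
      sumL (map g (withFirst N k)) ∎

  fills-≤ : ∀ c {N N′} d (g : List Content → Carrier) → N ≤ N′ →
            (∀ Fl → length Fl ≡ c → HasEntryAbove N Fl → g Fl ≈ 0#) →
            sumL (map g (fills N′ c d)) ≈ sumL (map g (fills N c d))
  fills-≤ c {N} {N′} d g N≤N′ g≈0 = P.subst (λ M → sumL (map g (fills M c d)) ≈ sumL (map g (fills N c d)))
                                      (NP.m+[n∸m]≡n N≤N′) (widen (N′ ∸ N))
    where
    widen : ∀ e → sumL (map g (fills (N N.+ e) c d)) ≈ sumL (map g (fills N c d))
    widen zero    rewrite NP.+-identityʳ N = refl
    widen (suc e) rewrite NP.+-suc N e = trans
      (fills-suc c (N N.+ e) d g (λ Fl len above → g≈0 Fl len (Any-map (Any-map (NP.≤-<-trans (NP.m≤m+n N e))) above)))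
      (widen e)

module GrowRow {c ℓ} (R : CommutativeRing c ℓ) (n : ℕ) (la mu r s : ℕ → ℕ) (k : ℕ) (x α β : ℕ → CommutativeRing.Carrier R)
  (mu-part : IsPartition n mu) (r-inc : WeakIncPos n r)
  (1≤k : 1 ≤ k) (k<n : k < n) (mu<la : mu k < la k) (s-eq : s k ≡ s (suc k)) (la-eq : la k ≡ la (suc k)) where

  open CommutativeRing R
  open WithRing R
  open Tableaux
  open TableauSums R

  cs : List (ℕ × ℕ)
  cs = cells n la mu

  weighted : (ℕ → ℕ) → List Content → Carrier
  weighted s₀ Fl = if validT r s₀ (zip cs Fl) then prodL (map (cellWt n la mu r s x α β) (zip cs Fl)) else 0#

  bound : (ℕ → ℕ) → ℕ
  bound s₀ = sumN (map s₀ (rangeL 1 n))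

  ≤-sumN : ∀ (f : ℕ → ℕ) {xs i} → i ∈ xs → f i ≤ sumN (map f xs)
  ≤-sumN f {a ∷ xs} (here P.refl) = NP.m≤m+n (f a) _
  ≤-sumN f {a ∷ xs} (there i∈)    = NP.≤-trans (≤-sumN f i∈) (NP.m≤n+m _ (f a))

  sumN-mono : ∀ {f g : ℕ → ℕ} xs → (∀ i → f i ≤ g i) → sumN (map f xs) ≤ sumN (map g xs)
  sumN-mono []       f≤g = z≤n
  sumN-mono (a ∷ xs) f≤g = NP.+-mono-≤ (f≤g a) (sumN-mono xs f≤g)

  invalid⇒0 : ∀ s₀ Fl → ¬ T (validT r s₀ (zip cs Fl)) → weighted s₀ Fl ≈ 0#
  invalid⇒0 s₀ Fl invalid = reflexive (if-false invalid)

  -- Grow enumerates fillings with entries ≤ bound s; the fillings that lowering s drops from the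
  -- enumeration have an entry above bound (minusUnit s k) and so are invalid anyway.
  Grow-minusUnit : Grow n la mu r s x α β ≋ Grow n la mu r (minusUnit s k) x α β
  Grow-minusUnit d = begin
    sumL (map (weighted s) (fills (bound s) (length cs) d))
      ≈⟨ sumL-cong (fills (bound s) (length cs) d) (λ Fl∈ → reflexive (P.cong (λ b → if b then _ else 0#)
           (Row.validT-minusUnit n la mu k mu-part 1≤k k<n mu<la la-eq _ (fills-length _ _ d Fl∈) r s s-eq))) ⟩
    sumL (map (weighted s′) (fills (bound s) (length cs) d))
      ≈⟨ fills-≤ (length cs) d (weighted s′) (sumN-mono (rangeL 1 n) (minusUnit-≤ s k))
           (λ Fl len above → invalid⇒0 s′ Fl (entry-above⇒invalid n la mu r s′ (bound s′) Fl len
              (λ i 1≤i i≤n → ≤-sumN s′ (∈-rangeL⁺ 1≤i i≤n)) above)) ⟩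
    sumL (map (weighted s′) (fills (bound s′) (length cs) d)) ∎
    where
    open SetoidReasoning setoid
    s′ : ℕ → ℕ
    s′ = minusUnit s k

  Grow-vanishes : s k ≡ 1 → Grow n la mu r (minusUnit s k) x α β ≋ zeroPS
  Grow-vanishes sk≡1 d = sumL-zero (fills (bound (minusUnit s k)) (length cs) d) λ Fl∈ →
    invalid⇒0 (minusUnit s k) _ (Row.no-valid n la mu k mu-part 1≤k k<n mu<la la-eq _ (fills-length _ _ d Fl∈) r (minusUnit s k)
      (P.trans (minusUnit-≡ s k) (P.cong (_∸ 1) sk≡1)) (proj₁ r-inc k 1≤k (NP.<⇒≤ k<n)))

lemma3p16 : ∀ {c ℓ : Level} (R : CommutativeRing c ℓ) (n : ℕ) (la mu r s : ℕ → ℕ) (k : ℕ)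
            (x α β : ℕ → CommutativeRing.Carrier R) →
            IsPartition n la → IsPartition n mu → Contained n mu la →
            WeakIncPos n r → WeakIncPos n s →
            1 ≤ k → k < n → mu k < la k → r k ≤ s k → s k ≡ s (suc k) → la k ≡ la (suc k) →
            let open WithRing R in
            (Grow n la mu r s x α β ≋ Grow n la mu r (minusUnit s k) x α β)
            × (Gtilde n la mu r s x α β ≋ Gtilde n la mu r (minusUnit s k) x α β)
            × (s k ≡ 1 → (Grow n la mu r (minusUnit s k) x α β ≋ zeroPS)
                         × (Gtilde n la mu r (minusUnit s k) x α β ≋ zeroPS))
lemma3p16 R n la mu r s (suc t) x α β la-part mu-part mu⊆la r-inc s-inc 1≤k@(s≤s z≤n) k<n mu<la r≤s s-eq la-eq =
  G.Grow-minusUnit , T.Gtilde-minusUnit , λ sk≡1 → G.Grow-vanishes sk≡1 , T.Gtilde-vanishes sk≡1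
  where
  module G = GrowRow R n la mu r s (suc t) x α β mu-part r-inc 1≤k k<n mu<la s-eq la-eq
  module T = GtildeRow R n la mu r s t x α β la-part mu-part mu⊆la r-inc s-inc k<n mu<la r≤s s-eq la-eq
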